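{- Let $n\ge3$ and let $C_n$ be the cycle with vertices $v_0,\dots,v_{n-1}$ and edges $v_iv_{i+1}$ (indices mod $n$), with basis $(v_0,v_0v_1)$. Let $0\le i\le\lfloor\frac{n-1}{2}\rfloor$. Then the total number, over all facet graphs $G$ of $C_n$, of Jaeger trees of $G$ with exactly $i$ tail-edges equals $\sum_{j=0}^{i}\binom{2j}{j}\binom{n-1-2j}{i-j}$.
   Context: A layering is $l:V\to\mathbb{Z}$ with $|l(u)-l(v)|\le1$ for every edge $uv$ of the graph such that $E_l=\{uv:|l(u)-l(v)|=1\}$ forms a connected spanning subgraph; its facet graph is $(V,E_l)$ with $uv$ oriented from $u$ (tail) to $v$ (head), written $\overrightarrow{uv}$, when $l(v)-l(u)=1$. Since each vertex of $C_n$ has degree 2, its ribbon structure is unique: $xy^+$ is the other edge at $x$. The tour of a spanning tree $T$ of a facet graph (taken in $C_n$): start at $(v_0,v_0v_1)$; from $(x,xy)$ go to $(x,xy^+)$ if $xy\notin T$ and to $(y,yx^+)$ if $xy\in T$; stop just before $(v_0,v_0v_1)$ recurs. $T$ is a Jaeger tree of $G$ if every edge $\overrightarrow{th}$ of $G$ not in $T$ has $(t,th)$ current before $(h,th)$ in the tour. $\overrightarrow{th}\in T$ is a tail-edge if $t$ and $v_0$ are in the same component of $T-th$. -}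

module Defs where

open import Data.Nat using (ℕ; zero; suc; _+_; _*_; _∸_; _≤_)
open import Data.Nat.DivMod using (_mod_)
open import Data.Nat.Combinatorics using (_C_)
open import Data.Integer as ℤ using (ℤ; +_; -[1+_])
open import Data.Fin using (Fin; toℕ) renaming (zero to fzero)
open import Data.Vec using (Vec; lookup)
open import Data.Fin.Subset using (Subset; _∈_; _∉_; ∣_∣)
open import Data.List using (List; map; upTo; length)
open import Data.Nat.ListAction using (sum)
open import Data.List.Relation.Unary.Unique.Propositional using (Unique)
open import Data.List.Membership.Propositional using () renaming (_∈_ to _∈ₗ_)
open import Data.Bool using (if_then_else_)
open import Data.Empty using (⊥)
open import Data.Product using (Σ; _×_; _,_; proj₁; proj₂)
open import Relation.Nullary using (¬_)
open import Relation.Binary.PropositionalEquality using (_≡_; _≢_)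
open import Function.Bundles using (_⇔_)

-- The cycle C_n : vertices v_0,…,v_{n-1} are Fin n; the edge with index
-- e : Fin n is v_e v_{e+1} (indices mod n).

nxt : ∀ {n} → Fin n → Fin n
nxt {suc m} i = suc (toℕ i) mod suc m

prv : ∀ {n} → Fin n → Fin n
prv {suc m} i = (toℕ i + m) mod suc m

data End : Set where
  lo hi : End

endVertex : ∀ {n} → Fin n → End → Fin n
endVertex e lo = e
endVertex e hi = nxt e

data Reach {n : ℕ} (P : Fin n → Set) (u : Fin n) : Fin n → Set where
  here   : Reach P u u
  up     : ∀ e → P e → Reach P u e → Reach P u (nxt e)
  down   : ∀ e → P e → Reach P u (nxt e) → Reach P u e

Connected : ∀ {n} → (Fin n → Set) → Set
Connected {n} P = (u v : Fin n) → Reach P u v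

IsLayering : ∀ {n} → (Fin n → ℤ) → Set
IsLayering {n} l =
  ((e : Fin n) → ℤ.∣ l (nxt e) ℤ.- l e ∣ ≤ 1)
  × Connected (λ e → ℤ.∣ l (nxt e) ℤ.- l e ∣ ≡ 1)

-- Orientation of an edge v_e v_{e+1} in an oriented spanning subgraph:
-- absent, forward (v_e → v_{e+1}), backward (v_{e+1} → v_e).
data Ori : Set where
  none fwd bwd : Ori

oriOf : ℤ → Ori
oriOf (+ 1)       = fwd
oriOf -[1+ 0 ]    = bwd
oriOf _           = none

facetOf : ∀ {n} → (Fin n → ℤ) → Fin n → Ori
facetOf l e = oriOf (l (nxt e) ℤ.- l e)

IsFacetGraph : ∀ {n} → Vec Ori n → Set
IsFacetGraph {n} G =
  Σ (Fin n → ℤ) λ l → IsLayering l × ((e : Fin n) → lookup G e ≡ facetOf l e)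

InG : ∀ {n} → Vec Ori n → Fin n → Set
InG G e = lookup G e ≢ none

tailEnd : Ori → End
tailEnd bwd = hi
tailEnd _   = lo

headEnd : Ori → End
headEnd bwd = lo
headEnd _   = hi

Minus : ∀ {n} → Subset n → Fin n → Fin n → Set
Minus T e f = f ∈ T × f ≢ e

-- T is a spanning tree of G: T ⊆ E(G), (V,T) connected, and acyclic
-- (every edge of T is a bridge: removing it disconnects its endpoints).
IsSpanningTree : ∀ {n} → Vec Ori n → Subset n → Set
IsSpanningTree {n} G T =
  ((e : Fin n) → e ∈ T → InG G e)
  × Connected (λ e → e ∈ T)
  × ((e : Fin n) → e ∈ T → ¬ Reach (Minus T e) e (nxt e))

-- The tour.  A current (x, xy) is a pair (e , s): the edge e and the end
-- s of e at which x lies.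

Current : ℕ → Set
Current n = Fin n × End

-- (x, xy) ↦ (x, xy⁺) : the other edge of C_n at x.
plus : ∀ {n} → Current n → Current n
plus (e , lo) = (prv e , hi)
plus (e , hi) = (nxt e , lo)

opp : ∀ {n} → Current n → Current n
opp (e , lo) = (e , hi)
opp (e , hi) = (e , lo)

tourStep : ∀ {n} → Subset n → Current n → Current n
tourStep T c = if lookup T (proj₁ c) then plus (opp c) else plus c

iter : ∀ {A : Set} → (A → A) → ℕ → A → A
iter f zero    a = a
iter f (suc k) a = f (iter f k a)

-- For T and start current c0, "c is current before d in the tour":
-- c occurs as the k-th current of the tour (k below the first return to
-- c0, i.e. within the tour), and d does not occur at any step j ≤ k.
Before : ∀ {n} → Subset n → Current n → Current n → Current n → Set
Before T c0 c d =
  Σ ℕ λ k → iter (tourStep T) k c0 ≡ c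
    × ((j : ℕ) → 1 ≤ j → j ≤ k → iter (tourStep T) j c0 ≢ c0)
    × ((j : ℕ) → j ≤ k → iter (tourStep T) j c0 ≢ d)

-- Jaeger trees of G (basis (v_0, v_0 v_1) = current (edge 0 , lo)).
IsJaeger : ∀ {n} → Vec Ori n → Subset n → Set
IsJaeger {zero}  G T = ⊥
IsJaeger {suc m} G T =
  IsSpanningTree G T
  × ((e : Fin (suc m)) → InG G e → e ∉ T →
       Before T (fzero , lo) (e , tailEnd (lookup G e)) (e , headEnd (lookup G e)))

IsTailEdge : ∀ {n} → Vec Ori n → Subset n → Fin n → Set
IsTailEdge {zero}  G T e = ⊥
IsTailEdge {suc m} G T e =
  e ∈ T × Reach (Minus T e) (endVertex e (tailEnd (lookup G e))) fzero

HasTailEdges : ∀ {n} → Vec Ori n → Subset n → ℕ → Set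
HasTailEdges {n} G T i =
  Σ (Subset n) λ S → ((e : Fin n) → (e ∈ S) ⇔ IsTailEdge G T e) × ∣ S ∣ ≡ i

Counted : (n i : ℕ) → Vec Ori n × Subset n → Set
Counted n i (G , T) = IsFacetGraph G × IsJaeger G T × HasTailEdges G T i

HasCard : {A : Set} → (A → Set) → ℕ → Set
HasCard {A} P N =
  Σ (List A) λ L → Unique L × ((x : A) → (x ∈ₗ L) ⇔ P x) × length L ≡ N

formula : ℕ → ℕ → ℕ
formula n i = sum (map (λ j → ((2 * j) C j) * ((n ∸ 1 ∸ 2 * j) C (i ∸ j))) (upTo (suc i)))

-- A spanning tree of C_n omits exactly one edge x, and a facet graph of C_n
-- is an orientation of all edges but at most one in which forward and
-- backward edges balance (the layering is the height function).  The tour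
-- of the path C_n - x meets x first at v_x, so the tree is a Jaeger tree
-- iff x is not oriented into v_x; its tail-edges are the edges oriented
-- towards x.  Read G from v_0 as a word a s b, with s the letter of x.  If
-- a has p forward letters, b has i - p backward ones, and balance forces s
-- (by the parity of n - 1) and |a| = 2p + D with D = ⌈(n-1)/2⌉ - i.  Hence
-- the count is
--   Σ_p C(2p + D, p) C(n - 1 - 2p - D, i - p),
-- which does not depend on D as long as 2i + D ≤ n - 1: the reflection
-- p ↦ i - p exchanges D with n - 1 - 2i - D, and Pascal's rule lets one
-- induct on i.  Its value at D = 0 is the claimed sum.

module Submission where

open import Defs
open import Data.Nat using (ℕ; suc; _≤_; _∸_; _/_; s≤s; z≤n)
open import Data.Nat.Properties using (≤-trans)

module BinomialSums where

  open import Data.Nat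
  open import Data.Nat.Properties
  open import Data.Nat.Combinatorics using (_C_; nCk+nC[k+1]≡[n+1]C[k+1])
  open import Data.Nat.Tactic.RingSolver using (solve-∀)
  open import Data.List using (map; applyUpTo)
  open import Data.Nat.ListAction using (sum)
  open import Relation.Binary.PropositionalEquality

  infix 8 _choose_

  _choose_ : ℕ → ℕ → ℕ
  _       choose zero    = 1
  zero    choose suc k   = 0
  (suc n) choose (suc k) = n choose k + n choose suc k

  choose≡C : ∀ n k → n choose k ≡ n C k
  choose≡C zero    zero    = refl
  choose≡C (suc n) zero    = refl
  choose≡C zero    (suc k) = refl
  choose≡C (suc n) (suc k) =
    trans (cong₂ _+_ (choose≡C n k) (choose≡C n (suc k))) (nCk+nC[k+1]≡[n+1]C[k+1] n k)

  Σ< : ℕ → (ℕ → ℕ) → ℕ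
  Σ< zero    f = 0
  Σ< (suc k) f = Σ< k f + f k

  Σ<-cong : ∀ k {f g : ℕ → ℕ} → (∀ p → p < k → f p ≡ g p) → Σ< k f ≡ Σ< k g
  Σ<-cong zero    f≡g = refl
  Σ<-cong (suc k) f≡g = cong₂ _+_ (Σ<-cong k (λ p p<k → f≡g p (m<n⇒m<1+n p<k))) (f≡g k ≤-refl)

  Σ<-distrib-+ : ∀ k (f g : ℕ → ℕ) → Σ< k (λ p → f p + g p) ≡ Σ< k f + Σ< k g
  Σ<-distrib-+ zero    f g = refl
  Σ<-distrib-+ (suc k) f g rewrite Σ<-distrib-+ k f g = interchange (Σ< k f) (Σ< k g) (f k) (g k)
    where
    interchange : ∀ a b c d → (a + b) + (c + d) ≡ (a + c) + (b + d)
    interchange = solve-∀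

  Σ<-suc : ∀ k (f : ℕ → ℕ) → Σ< (suc k) f ≡ f 0 + Σ< k (λ p → f (suc p))
  Σ<-suc zero    f = +-comm 0 (f 0)
  Σ<-suc (suc k) f rewrite Σ<-suc k f = +-assoc (f 0) (Σ< k (λ p → f (suc p))) (f (suc k))

  Σ<-+ : ∀ a b (f : ℕ → ℕ) → Σ< (a + b) f ≡ Σ< a f + Σ< b (λ k → f (a + k))
  Σ<-+ a zero    f = trans (cong (λ z → Σ< z f) (+-identityʳ a)) (sym (+-identityʳ _))
  Σ<-+ a (suc b) f = trans (cong (λ z → Σ< z f) (+-suc a b))
    (trans (cong (_+ f (a + b)) (Σ<-+ a b f)) (+-assoc (Σ< a f) _ _))

  Σ<-reverse : ∀ k (f : ℕ → ℕ) → Σ< k f ≡ Σ< k (λ p → f (k ∸ suc p))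
  Σ<-reverse zero    f = refl
  Σ<-reverse (suc k) f = begin
    Σ< k f + f k                             ≡⟨ cong (_+ f k) (Σ<-reverse k f) ⟩
    Σ< k (λ p → f (k ∸ suc p)) + f k         ≡⟨ +-comm _ (f k) ⟩
    f k + Σ< k (λ p → f (k ∸ suc p))         ≡⟨ Σ<-suc k (λ p → f (suc k ∸ suc p)) ⟨
    Σ< (suc k) (λ p → f (suc k ∸ suc p))     ∎
    where open ≡-Reasoning

  sum-map-applyUpTo : ∀ k (f g : ℕ → ℕ) → sum (map f (applyUpTo g k)) ≡ Σ< k (λ p → f (g p))
  sum-map-applyUpTo zero    f g = refl
  sum-map-applyUpTo (suc k) f g =
    trans (cong (f (g 0) +_) (sum-map-applyUpTo k f (λ p → g (suc p)))) (sym (Σ<-suc k (λ p → f (g p))))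

  binomialTerm : (D N i p : ℕ) → ℕ
  binomialTerm D N i p = (2 * p + D) choose p * (N ∸ (2 * p + D)) choose (i ∸ p)

  -- The theorem's sum is shiftedSum 0 (n - 1) i.
  shiftedSum : (D N i : ℕ) → ℕ
  shiftedSum D N i = Σ< (suc i) (binomialTerm D N i)

  shiftedSum-pascal : ∀ D N i → D + 2 * suc i ≤ suc N →
    shiftedSum D (suc N) (suc i) ≡ shiftedSum D N i + shiftedSum D N (suc i)
  shiftedSum-pascal D N i bound = begin
    Σ< (suc i) (term (suc N) (suc i)) + term (suc N) (suc i) (suc i)
      ≡⟨ cong₂ _+_ (trans (Σ<-cong (suc i) termwise) (Σ<-distrib-+ (suc i) (term N i) (term N (suc i)))) lastTerm ⟩
    (shiftedSum D N i + Σ< (suc i) (term N (suc i))) + term N (suc i) (suc i)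
      ≡⟨ +-assoc (shiftedSum D N i) _ _ ⟩
    shiftedSum D N i + shiftedSum D N (suc i)
      ∎
    where
    open ≡-Reasoning
    term : ℕ → ℕ → ℕ → ℕ
    term = binomialTerm D
    lastTerm : term (suc N) (suc i) (suc i) ≡ term N (suc i) (suc i)
    lastTerm rewrite n∸n≡0 i = refl
    termwise : ∀ p → p < suc i → term (suc N) (suc i) p ≡ term N i p + term N (suc i) p
    termwise p p<1+i = begin
      c * (suc N ∸ x) choose (suc i ∸ p)
        ≡⟨ cong₂ (λ a b → c * a choose b) (+-∸-assoc 1 x≤N) 1+i∸p ⟩
      c * ((N ∸ x) choose (i ∸ p) + (N ∸ x) choose suc (i ∸ p))
        ≡⟨ *-distribˡ-+ c _ _ ⟩
      term N i p + c * (N ∸ x) choose suc (i ∸ p)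
        ≡⟨ cong (λ b → term N i p + c * (N ∸ x) choose b) 1+i∸p ⟨
      term N i p + term N (suc i) p
        ∎
      where
      x = 2 * p + D
      c = x choose p
      p≤i : p ≤ i
      p≤i = ≤-pred p<1+i
      1+i∸p : suc i ∸ p ≡ suc (i ∸ p)
      1+i∸p = +-∸-assoc 1 p≤i
      shape : ∀ D i → D + 2 * suc i ≡ suc (suc (2 * i + D))
      shape = solve-∀
      x≤N : x ≤ N
      x≤N = ≤-trans (+-monoˡ-≤ D (*-monoʳ-≤ 2 p≤i))
        (≤-pred (≤-trans (n≤1+n _) (subst (_≤ suc N) (shape D i) bound)))

  binomialTerm-reflect : ∀ D F i p q → p + q ≡ i →
    binomialTerm D (2 * i + (D + F)) i q ≡ binomialTerm F (2 * i + (D + F)) i p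
  binomialTerm-reflect D F .(p + q) p q refl = begin
    (2 * q + D) choose q * (N ∸ (2 * q + D)) choose (p + q ∸ q)
      ≡⟨ cong₂ (λ a b → (2 * q + D) choose q * a choose b) N∸[2q+D] (m+n∸n≡m p q) ⟩
    (2 * q + D) choose q * (2 * p + F) choose p
      ≡⟨ *-comm ((2 * q + D) choose q) _ ⟩
    (2 * p + F) choose p * (2 * q + D) choose q
      ≡⟨ cong₂ (λ a b → (2 * p + F) choose p * a choose b) N∸[2p+F] (m+n∸m≡n p q) ⟨
    (2 * p + F) choose p * (N ∸ (2 * p + F)) choose (p + q ∸ p)
      ∎
    where
    open ≡-Reasoning
    N = 2 * (p + q) + (D + F)
    split : N ≡ (2 * q + D) + (2 * p + F)
    split = shape p q D F
      where
      shape : ∀ p q D F → 2 * (p + q) + (D + F) ≡ (2 * q + D) + (2 * p + F)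
      shape = solve-∀
    N∸[2q+D] : N ∸ (2 * q + D) ≡ 2 * p + F
    N∸[2q+D] = trans (cong (_∸ (2 * q + D)) split) (m+n∸m≡n (2 * q + D) (2 * p + F))
    N∸[2p+F] : N ∸ (2 * p + F) ≡ 2 * q + D
    N∸[2p+F] = trans (cong (_∸ (2 * p + F)) (trans split (+-comm (2 * q + D) _))) (m+n∸m≡n (2 * p + F) (2 * q + D))

  shiftedSum-reflect : ∀ D F i N → N ≡ 2 * i + (D + F) → shiftedSum D N i ≡ shiftedSum F N i
  shiftedSum-reflect D F i .(2 * i + (D + F)) refl =
    trans (Σ<-reverse (suc i) _) (Σ<-cong (suc i) λ p p<1+i →
      binomialTerm-reflect D F i p (i ∸ p) (m+[n∸m]≡n (≤-pred p<1+i)))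

  shiftedSum-suc-pascal : ∀ i D F N → suc N ≡ 2 * suc i + (suc D + suc F) →
    (N ≡ 2 * i + (suc D + suc (suc F)) → shiftedSum D N i ≡ shiftedSum (suc D) N i) →
    (N ≡ 2 * suc i + (suc D + F) → shiftedSum D N (suc i) ≡ shiftedSum (suc D) N (suc i)) →
    shiftedSum D (suc N) (suc i) ≡ shiftedSum (suc D) (suc N) (suc i)
  shiftedSum-suc-pascal i D F N eq IH IH′ = begin
    shiftedSum D (suc N) (suc i)                           ≡⟨ shiftedSum-pascal D N i (bound (n≤1+n D)) ⟩
    shiftedSum D N i + shiftedSum D N (suc i)              ≡⟨ cong₂ _+_ (IH eq₁) (IH′ eq₂) ⟩
    shiftedSum (suc D) N i + shiftedSum (suc D) N (suc i)  ≡⟨ shiftedSum-pascal (suc D) N i (bound ≤-refl) ⟨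
    shiftedSum (suc D) (suc N) (suc i)                     ∎
    where
    open ≡-Reasoning
    shape₁ : ∀ i D F → suc D + 2 * suc i + suc F ≡ 2 * suc i + (suc D + suc F)
    shape₁ = solve-∀
    shape₂ : ∀ i D F → 2 * suc i + (suc D + suc F) ≡ suc (2 * i + (suc D + suc (suc F)))
    shape₂ = solve-∀
    shape₃ : ∀ i D F → 2 * suc i + (suc D + suc F) ≡ suc (2 * suc i + (suc D + F))
    shape₃ = solve-∀
    bound : ∀ {d} → d ≤ suc D → d + 2 * suc i ≤ suc N
    bound d≤1+D = ≤-trans (+-monoˡ-≤ (2 * suc i) d≤1+D)
      (≤-trans (m≤m+n _ (suc F)) (≤-reflexive (trans (shape₁ i D F) (sym eq))))
    eq₁ : N ≡ 2 * i + (suc D + suc (suc F))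
    eq₁ = suc-injective (trans eq (shape₂ i D F))
    eq₂ : N ≡ 2 * suc i + (suc D + F)
    eq₂ = suc-injective (trans eq (shape₃ i D F))

  shiftedSum-0≡1 : ∀ i F N → N ≡ 2 * i + suc F → shiftedSum 0 N i ≡ shiftedSum 1 N i
  shiftedSum-0≡1 zero    F       N       eq = refl
  shiftedSum-0≡1 i       zero    N       eq = shiftedSum-reflect 0 1 i N eq
  shiftedSum-0≡1 (suc i) (suc F) zero    ()
  shiftedSum-0≡1 (suc i) (suc F) (suc N) eq =
    shiftedSum-suc-pascal i 0 F N eq (shiftedSum-0≡1 i (suc (suc F)) N) (shiftedSum-0≡1 (suc i) F N)

  -- The boundary case F = 0 is turned by two reflections into the case D = 0,
  -- which therefore needs its own induction (shiftedSum-0≡1).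
  shiftedSum-suc : ∀ i D F N → N ≡ 2 * i + (suc D + F) → shiftedSum D N i ≡ shiftedSum (suc D) N i
  shiftedSum-suc zero    D       F       N       eq = refl
  shiftedSum-suc i       zero    F       N       eq = shiftedSum-0≡1 i F N eq
  shiftedSum-suc i       (suc D) zero    N       eq = begin
    shiftedSum (suc D) N i        ≡⟨ shiftedSum-reflect (suc D) 1 i N (trans eq′ (cong (2 * i +_) (+-comm 1 (suc D)))) ⟩
    shiftedSum 1 N i              ≡⟨ shiftedSum-0≡1 i (suc D) N eq′ ⟨
    shiftedSum 0 N i              ≡⟨ shiftedSum-reflect 0 (suc (suc D)) i N eq′ ⟩
    shiftedSum (suc (suc D)) N i  ∎
    where
    open ≡-Reasoning
    eq′ : N ≡ 2 * i + suc (suc D)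
    eq′ = trans eq (cong (2 * i +_) (+-identityʳ (suc (suc D))))
  shiftedSum-suc (suc i) (suc D) (suc F) zero    ()
  shiftedSum-suc (suc i) (suc D) (suc F) (suc N) eq =
    shiftedSum-suc-pascal i (suc D) F N eq (shiftedSum-suc i (suc D) (suc (suc F)) N) (shiftedSum-suc (suc i) (suc D) F N)

  shiftedSum-shift : ∀ i D F N → N ≡ 2 * i + (D + F) → shiftedSum D N i ≡ shiftedSum 0 N i
  shiftedSum-shift i zero    F N eq = refl
  shiftedSum-shift i (suc D) F N eq =
    trans (sym (shiftedSum-suc i D F N eq)) (shiftedSum-shift i D (suc F) N (trans eq (cong (2 * i +_) (sym (+-suc D F)))))

module CycleConnectivity where

  open import Data.Nat
  open import Data.Nat.Properties
  open import Data.Nat.DivMod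
  open import Data.Fin using (Fin; toℕ) renaming (zero to fzero)
  open import Data.Fin.Properties using (toℕ-injective; toℕ-fromℕ<; toℕ<n; toℕ≤pred[n])
  open import Relation.Binary.PropositionalEquality
  open import Relation.Nullary using (¬_; yes; no)
  open import Data.Empty using (⊥-elim)
  open import Data.Sum using (inj₁; inj₂)
  open import Data.Product using (_×_; _,_; proj₁)
  open import Relation.Binary.Definitions using (tri<; tri≈; tri>)

  module _ {m : ℕ} where

    vertex : ℕ → Fin (suc m)
    vertex k = k mod suc m

    toℕ-vertex : ∀ k → k < suc m → toℕ (vertex k) ≡ k
    toℕ-vertex k k<n = trans (toℕ-fromℕ< _) (m<n⇒m%n≡m k<n)

    vertex-toℕ : (e : Fin (suc m)) → vertex (toℕ e) ≡ e
    vertex-toℕ e = toℕ-injective (toℕ-vertex (toℕ e) (toℕ<n e))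

    vertex-n : vertex (suc m) ≡ fzero
    vertex-n = toℕ-injective (trans (toℕ-fromℕ< _) (n%n≡0 (suc m)))

    toℕ-nxt : (e : Fin (suc m)) → toℕ (nxt e) ≡ suc (toℕ e) % suc m
    toℕ-nxt e = toℕ-fromℕ< _

    nxt-vertex : ∀ k → k < suc m → nxt (vertex k) ≡ vertex (suc k)
    nxt-vertex k k<n = toℕ-injective (trans (toℕ-nxt (vertex k))
      (trans (cong (λ x → suc x % suc m) (toℕ-vertex k k<n)) (sym (toℕ-fromℕ< _))))

    toℕ-nxt-< : (e : Fin (suc m)) → toℕ e < m → toℕ (nxt e) ≡ suc (toℕ e)
    toℕ-nxt-< e e<m = trans (toℕ-nxt e) (m<n⇒m%n≡m (s≤s e<m))

    toℕ-nxt-last : (e : Fin (suc m)) → toℕ e ≡ m → toℕ (nxt e) ≡ 0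
    toℕ-nxt-last e e≡m = trans (toℕ-nxt e) (trans (cong (λ x → suc x % suc m) e≡m) (n%n≡0 (suc m)))

    InArc : Fin (suc m) → Fin (suc m) → Fin (suc m) → Set
    InArc x y v = toℕ x < toℕ v × toℕ v ≤ toℕ y

    module _ {P : Fin (suc m) → Set} where

      Reach-trans : ∀ {u v w} → Reach P u v → Reach P v w → Reach P u w
      Reach-trans r here          = r
      Reach-trans r (up e p r′)   = up e p (Reach-trans r r′)
      Reach-trans r (down e p r′) = down e p (Reach-trans r r′)

      Reach-sym : ∀ {u v} → Reach P u v → Reach P v u
      Reach-sym here         = here
      Reach-sym (up e p r)   = Reach-trans (down e p here) (Reach-sym r)
      Reach-sym (down e p r) = Reach-trans (up e p here) (Reach-sym r)

      Reach-invariant : (S : Fin (suc m) → Set) →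
        (∀ e → P e → S e → S (nxt e)) → (∀ e → P e → S (nxt e) → S e) →
        ∀ {u v} → Reach P u v → S u → S v
      Reach-invariant S step back here         s = s
      Reach-invariant S step back (up e p r)   s = step e p (Reach-invariant S step back r s)
      Reach-invariant S step back (down e p r) s = back e p (Reach-invariant S step back r s)

      reach-along : ∀ a b → a ≤ b → b ≤ suc m → (∀ e → a ≤ toℕ e → toℕ e < b → P e) →
        Reach P (vertex a) (vertex b)
      reach-along a zero    z≤n _ _ = here
      reach-along a (suc b) a≤1+b 1+b≤n present with m≤n⇒m<n∨m≡n a≤1+b
      ... | inj₂ refl = here
      ... | inj₁ a≤b  = subst (Reach P (vertex a)) (nxt-vertex b 1+b≤n)
        (up (vertex b) (present (vertex b) (subst (a ≤_) (sym b≡) (≤-pred a≤b)) (≤-reflexive (cong suc b≡)))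
            (reach-along a b (≤-pred a≤b) (≤-trans (n≤1+n b) 1+b≤n)
              (λ e a≤e e<b → present e a≤e (m<n⇒m<1+n e<b))))
        where
        b≡ : toℕ (vertex b) ≡ b
        b≡ = toℕ-vertex b 1+b≤n

      reach-0-downwards : ∀ v → (∀ e → toℕ e < toℕ v → P e) → Reach P v fzero
      reach-0-downwards v present = subst (λ u → Reach P u fzero) (vertex-toℕ v)
        (Reach-sym (reach-along 0 (toℕ v) z≤n (≤-trans (toℕ≤pred[n] v) (n≤1+n m)) (λ e _ → present e)))

      reach-0-upwards : ∀ v → (∀ e → toℕ v ≤ toℕ e → P e) → Reach P v fzero
      reach-0-upwards v present = subst₂ (Reach P) (vertex-toℕ v) vertex-n
        (reach-along (toℕ v) (suc m) (≤-trans (toℕ≤pred[n] v) (n≤1+n m)) ≤-refl (λ e v≤e _ → present e v≤e))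

      connected-via-0 : (∀ v → Reach P v fzero) → Connected P
      connected-via-0 reach u v = Reach-trans (reach u) (Reach-sym (reach v))

      -- v reaches v_0 downwards if v ≤ x and upwards, across v_n = v_0, otherwise.
      connected-all-but : ∀ x → (∀ e → e ≢ x → P e) → Connected P
      connected-all-but x present = connected-via-0 reach
        where
        reach : ∀ v → Reach P v fzero
        reach v with toℕ v ≤? toℕ x
        ... | yes v≤x = reach-0-downwards v λ e e<v → present e λ { refl → <⇒≱ e<v v≤x }
        ... | no  v≰x = reach-0-upwards v λ e v≤e → present e λ { refl → v≰x v≤e }

      InArc-closed : ∀ x y → toℕ x < toℕ y → ¬ P x → ¬ P y →
        ∀ {u v} → Reach P u v → InArc x y u → InArc x y v
      InArc-closed x y x<y ¬Px ¬Py = Reach-invariant (InArc x y) forward backward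
        where
        forward : ∀ e → P e → InArc x y e → InArc x y (nxt e)
        forward e Pe (x<e , e≤y) with m≤n⇒m<n∨m≡n e≤y
        ... | inj₂ e≡y = ⊥-elim (¬Py (subst P (toℕ-injective e≡y) Pe))
        ... | inj₁ e<y rewrite toℕ-nxt-< e (≤-trans e<y (toℕ≤pred[n] y)) = m<n⇒m<1+n x<e , e<y
        backward : ∀ e → P e → InArc x y (nxt e) → InArc x y e
        backward e Pe (x<e+1 , e+1≤y) with m≤n⇒m<n∨m≡n (toℕ≤pred[n] e)
        ... | inj₂ e≡m with () ← subst (toℕ x <_) (toℕ-nxt-last e e≡m) x<e+1
        ... | inj₁ e<m rewrite toℕ-nxt-< e e<m with m≤n⇒m<n∨m≡n (≤-pred x<e+1)
        ...   | inj₁ x<e = x<e , ≤-trans (n≤1+n _) e+1≤y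
        ...   | inj₂ x≡e = ⊥-elim (¬Px (subst P (toℕ-injective (sym x≡e)) Pe))

      two-missing⇒disconnected : ∀ x y → x ≢ y → ¬ P x → ¬ P y → ¬ Connected P
      two-missing⇒disconnected x y x≢y ¬Px ¬Py connected with <-cmp (toℕ x) (toℕ y)
      ... | tri< x<y _ _ = <-irrefl refl (proj₁ (InArc-closed x y x<y ¬Px ¬Py (connected y x) (x<y , ≤-refl)))
      ... | tri≈ _ x≡y _ = x≢y (toℕ-injective x≡y)
      ... | tri> _ _ y<x = <-irrefl refl (proj₁ (InArc-closed y x y<x ¬Py ¬Px (connected x y) (y<x , ≤-refl)))

module FacetGraphs where

  open BinomialSums using (Σ<)
  open CycleConnectivity
  open import Data.Nat as ℕ using (ℕ; zero; suc; s≤s; z≤n)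
  import Data.Nat.Properties as ℕ
  open import Data.Integer as ℤ using (ℤ; +_; -[1+_])
  import Data.Integer.Properties as ℤ
  open import Data.Integer.Tactic.RingSolver using (solve-∀)
  open import Data.Fin using (Fin; toℕ) renaming (zero to fzero)
  open import Data.Fin.Properties using (toℕ≤pred[n])
  open import Data.Vec using (Vec; lookup)
  open import Relation.Binary.PropositionalEquality
  open import Data.Empty using (⊥-elim)
  open import Data.Sum using (_⊎_; inj₁; inj₂)
  open import Data.Product using (_,_)

  rise : Ori → ℤ
  rise none = + 0
  rise fwd  = + 1
  rise bwd  = -[1+ 0 ]

  #fwd : Ori → ℕ
  #fwd fwd = 1
  #fwd _   = 0

  #bwd : Ori → ℕ
  #bwd bwd = 1
  #bwd _   = 0

  rise≡#fwd-#bwd : ∀ o → rise o ≡ + #fwd o ℤ.- + #bwd o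
  rise≡#fwd-#bwd none = refl
  rise≡#fwd-#bwd fwd  = refl
  rise≡#fwd-#bwd bwd  = refl

  rise-oriOf : ∀ z → ℤ.∣ z ∣ ℕ.≤ 1 → rise (oriOf z) ≡ z
  rise-oriOf (+ 0)            _ = refl
  rise-oriOf (+ 1)            _ = refl
  rise-oriOf (+ suc (suc k))  (s≤s ())
  rise-oriOf -[1+ 0 ]         _ = refl
  rise-oriOf -[1+ suc k ]     (s≤s ())

  oriOf-rise : ∀ o → oriOf (rise o) ≡ o
  oriOf-rise none = refl
  oriOf-rise fwd  = refl
  oriOf-rise bwd  = refl

  ∣rise∣≤1 : ∀ o → ℤ.∣ rise o ∣ ℕ.≤ 1
  ∣rise∣≤1 none = z≤n
  ∣rise∣≤1 fwd  = s≤s z≤n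
  ∣rise∣≤1 bwd  = s≤s z≤n

  ∣rise∣≡1 : ∀ {o} → o ≢ none → ℤ.∣ rise o ∣ ≡ 1
  ∣rise∣≡1 {none} o≢none = ⊥-elim (o≢none refl)
  ∣rise∣≡1 {fwd}  _      = refl
  ∣rise∣≡1 {bwd}  _      = refl

  rise-difference : ∀ (F f B b : ℕ) → (+ (F ℕ.+ f) ℤ.- + (B ℕ.+ b)) ℤ.- (+ F ℤ.- + B) ≡ + f ℤ.- + b
  rise-difference F f B b rewrite ℤ.pos-+ F f | ℤ.pos-+ B b = ring (+ F) (+ f) (+ B) (+ b)
    where
    ring : ∀ F f B b → (F ℤ.+ f ℤ.- (B ℤ.+ b)) ℤ.- (F ℤ.- B) ≡ f ℤ.- b
    ring = solve-∀

  module _ {m : ℕ} where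

    orientationAt : Vec Ori (suc m) → ℕ → Ori
    orientationAt G k = lookup G (vertex k)

    fwdBelow bwdBelow : Vec Ori (suc m) → ℕ → ℕ
    fwdBelow G k = Σ< k (λ j → #fwd (orientationAt G j))
    bwdBelow G k = Σ< k (λ j → #bwd (orientationAt G j))

    Balanced : Vec Ori (suc m) → Set
    Balanced G = fwdBelow G (suc m) ≡ bwdBelow G (suc m)

    AllOrientedBut : Fin (suc m) → Vec Ori (suc m) → Set
    AllOrientedBut x G = ∀ e → e ≢ x → lookup G e ≢ none

    facetGraph⇒balanced : ∀ G → IsFacetGraph G → Balanced G
    facetGraph⇒balanced G (l , (bounded , _) , realises) =
      ℤ.+-injective (ℤ.i-j≡0⇒i≡j _ _ (trans (sym (height (suc m) ℕ.≤-refl))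
        (trans (cong (λ v → l v ℤ.- l fzero) vertex-n) (ℤ.+-inverseʳ (l fzero)))))
      where
      step : ∀ k → k ℕ.< suc m → l (vertex (suc k)) ℤ.- l (vertex k) ≡ rise (orientationAt G k)
      step k k<n = sym (trans (cong rise (realises (vertex k)))
        (trans (rise-oriOf _ (bounded (vertex k))) (cong (λ v → l v ℤ.- l (vertex k)) (nxt-vertex k k<n))))
      height : ∀ k → k ℕ.≤ suc m → l (vertex k) ℤ.- l fzero ≡ + fwdBelow G k ℤ.- + bwdBelow G k
      height zero    _       = ℤ.+-inverseʳ (l fzero)
      height (suc k) 1+k≤n = begin
        l (vertex (suc k)) ℤ.- l fzero
          ≡⟨ telescope (l (vertex (suc k))) (l (vertex k)) (l fzero) ⟩
        (l (vertex (suc k)) ℤ.- l (vertex k)) ℤ.+ (l (vertex k) ℤ.- l fzero)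
          ≡⟨ cong₂ ℤ._+_ (trans (step k 1+k≤n) (rise≡#fwd-#bwd _))
                         (height k (ℕ.≤-trans (ℕ.n≤1+n k) 1+k≤n)) ⟩
        (+ f ℤ.- + b) ℤ.+ (+ fwdBelow G k ℤ.- + bwdBelow G k)
          ≡⟨ regroup f b (fwdBelow G k) (bwdBelow G k) ⟩
        + fwdBelow G (suc k) ℤ.- + bwdBelow G (suc k)
          ∎
        where
        open ≡-Reasoning
        f = #fwd (orientationAt G k)
        b = #bwd (orientationAt G k)
        telescope : ∀ a b c → a ℤ.- c ≡ (a ℤ.- b) ℤ.+ (b ℤ.- c)
        telescope = solve-∀
        regroup : ∀ f b F B → (+ f ℤ.- + b) ℤ.+ (+ F ℤ.- + B) ≡ + (F ℕ.+ f) ℤ.- + (B ℕ.+ b)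
        regroup f b F B rewrite ℤ.pos-+ F f | ℤ.pos-+ B b = ring (+ f) (+ b) (+ F) (+ B)
          where
          ring : ∀ f b F B → (f ℤ.- b) ℤ.+ (F ℤ.- B) ≡ (F ℤ.+ f) ℤ.- (B ℤ.+ b)
          ring = solve-∀

    -- The layering is the height function: the number of forward minus
    -- backward edges before the vertex.
    balanced⇒facetGraph : ∀ G x → Balanced G → AllOrientedBut x G → IsFacetGraph G
    balanced⇒facetGraph G x balanced oriented = l , (bounded , connected) , realises
      where
      l : Fin (suc m) → ℤ
      l v = + fwdBelow G (toℕ v) ℤ.- + bwdBelow G (toℕ v)
      step : ∀ e → l (nxt e) ℤ.- l e ≡ rise (lookup G e)
      step e = byPosition (ℕ.m≤n⇒m<n∨m≡n (toℕ≤pred[n] e))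
        where
        o = orientationAt G (toℕ e)
        F = fwdBelow G (toℕ e)
        B = bwdBelow G (toℕ e)
        f = #fwd o
        b = #bwd o
        riseₑ : + f ℤ.- + b ≡ rise (lookup G e)
        riseₑ = trans (sym (rise≡#fwd-#bwd o)) (cong (λ v → rise (lookup G v)) (vertex-toℕ e))
        byPosition : toℕ e ℕ.< m ⊎ toℕ e ≡ m → l (nxt e) ℤ.- l e ≡ rise (lookup G e)
        byPosition (inj₁ e<m) rewrite toℕ-nxt-< e e<m = trans (rise-difference F f B b) riseₑ
        byPosition (inj₂ e≡m) rewrite toℕ-nxt-last e e≡m =
          trans (cong (ℤ._- l e) (sym l[nxt]≡0)) (trans (rise-difference F f B b) riseₑ)
          where
          l[nxt]≡0 : + (F ℕ.+ f) ℤ.- + (B ℕ.+ b) ≡ + 0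
          l[nxt]≡0 = trans (cong₂ (λ u v → + u ℤ.- + v) (trans (cong (λ k → fwdBelow G (suc k)) e≡m) balanced)
                                                       (cong (λ k → bwdBelow G (suc k)) e≡m))
                           (ℤ.+-inverseʳ (+ bwdBelow G (suc m)))
      bounded : ∀ e → ℤ.∣ l (nxt e) ℤ.- l e ∣ ℕ.≤ 1
      bounded e rewrite step e = ∣rise∣≤1 (lookup G e)
      connected : Connected (λ e → ℤ.∣ l (nxt e) ℤ.- l e ∣ ≡ 1)
      connected = connected-all-but x λ e e≢x → trans (cong ℤ.∣_∣ (step e)) (∣rise∣≡1 (oriented e e≢x))
      realises : ∀ e → lookup G e ≡ facetOf l e
      realises e = trans (sym (oriOf-rise (lookup G e))) (cong oriOf (sym (step e)))

module SpanningTrees where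

  open CycleConnectivity
  open FacetGraphs using (AllOrientedBut)
  open import Data.Nat as ℕ using (ℕ; zero; suc; s≤s)
  import Data.Nat.Properties as ℕ
  open import Data.Fin using (Fin; toℕ) renaming (zero to fzero)
  open import Data.Fin.Properties as Fin using (toℕ-injective; toℕ≤pred[n])
  open import Data.Fin.Subset using (Subset; _∈_; _∉_; ∁; ⁅_⁆)
  open import Data.Fin.Subset.Properties
    using (_∈?_; x∈⁅x⁆; x∈⁅y⁆⇒x≡y; x≢y⇒x∉⁅y⁆; x∈∁p⇒x∉p; x∉p⇒x∈∁p; x∉∁p⇒x∈p; ⊆-antisym)
  open import Data.Vec using (Vec; lookup)
  open import Data.Vec.Properties using ([]=⇒lookup)
  open import Data.Bool using (true)
  open import Relation.Binary.PropositionalEquality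
  open import Relation.Nullary using (¬_; yes; no; ¬?)
  open import Data.Empty using (⊥-elim)
  open import Data.Sum using (_⊎_; inj₁; inj₂)
  open import Data.Product using (Σ; _×_; _,_; proj₁; proj₂)
  open import Function.Bundles using (_⇔_; mk⇔)
  open import Relation.Binary.Definitions using (tri<; tri≈; tri>)

  module _ {m : ℕ} where

    allBut : Fin (suc m) → Subset (suc m)
    allBut x = ∁ ⁅ x ⁆

    ∈-allBut : ∀ {e x} → e ≢ x → e ∈ allBut x
    ∈-allBut e≢x = x∉p⇒x∈∁p (x≢y⇒x∉⁅y⁆ e≢x)

    ∈-allBut⇒≢ : ∀ {e x} → e ∈ allBut x → e ≢ x
    ∈-allBut⇒≢ e∈ refl = x∈∁p⇒x∉p e∈ (x∈⁅x⁆ _)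

    ∉-allBut : ∀ x → x ∉ allBut x
    ∉-allBut x x∈ = ∈-allBut⇒≢ x∈ refl

    allBut-injective : ∀ x y → allBut x ≡ allBut y → x ≡ y
    allBut-injective x y eq = x∈⁅y⁆⇒x≡y y (x∉∁p⇒x∈p (subst (x ∉_) eq (∉-allBut x)))

    module _ {x e : Fin (suc m)} where

      private
        e-missing : ¬ Minus (allBut x) e e
        e-missing (_ , e≢e) = e≢e refl

        x-missing : ¬ Minus (allBut x) e x
        x-missing (x∈ , _) = ∉-allBut x x∈

      cut-below : toℕ e ℕ.< toℕ x → ∀ {v} → Reach (Minus (allBut x) e) (nxt e) v → InArc e x v
      cut-below e<x r = InArc-closed e x e<x e-missing x-missing r
        (ℕ.≤-reflexive (sym nxt≡) , ℕ.≤-trans (ℕ.≤-reflexive nxt≡) e<x)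
        where
        nxt≡ : toℕ (nxt e) ≡ suc (toℕ e)
        nxt≡ = toℕ-nxt-< e (ℕ.≤-trans e<x (toℕ≤pred[n] x))

      cut-above : toℕ x ℕ.< toℕ e → ∀ {v} → Reach (Minus (allBut x) e) e v → InArc x e v
      cut-above x<e r = InArc-closed x e x<e x-missing e-missing r (x<e , ℕ.≤-refl)

    allBut-acyclic : ∀ x e → e ∈ allBut x → ¬ Reach (Minus (allBut x) e) e (nxt e)
    allBut-acyclic x e e∈ r with ℕ.<-cmp (toℕ e) (toℕ x)
    ... | tri≈ _ e≡x _ = ∈-allBut⇒≢ e∈ (toℕ-injective e≡x)
    ... | tri< e<x _ _ = ℕ.<-irrefl refl (proj₁ (cut-below e<x (Reach-sym r)))
    ... | tri> _ _ x<e with cut-above x<e r | ℕ.m≤n⇒m<n∨m≡n (toℕ≤pred[n] e)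
    ...   | x<e+1 , e+1≤e | inj₁ e<m = ℕ.<-irrefl refl (ℕ.≤-trans (ℕ.≤-reflexive (sym (toℕ-nxt-< e e<m))) e+1≤e)
    ...   | x<e+1 , _     | inj₂ e≡m with () ← subst (toℕ x ℕ.<_) (toℕ-nxt-last e e≡m) x<e+1

    allBut-isSpanningTree : ∀ G x → AllOrientedBut x G → IsSpanningTree G (allBut x)
    allBut-isSpanningTree G x oriented =
      (λ e e∈ → oriented e (∈-allBut⇒≢ e∈)) ,
      connected-all-but x (λ e → ∈-allBut) ,
      allBut-acyclic x

    -- A spanning tree of C_n omits exactly one edge: two omitted edges
    -- disconnect, none leaves the cycle.
    spanningTree⇒allBut : 1 ℕ.≤ m → ∀ G T → IsSpanningTree G T →
      Σ (Fin (suc m)) λ x → T ≡ allBut x × AllOrientedBut x G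
    spanningTree⇒allBut 1≤m G T (inG , connected , acyclic) with Fin.any? (λ e → ¬? (e ∈? T))
    ... | yes (x , x∉T) = x , T≡ , λ e e≢x → inG e (others e e≢x)
      where
      others : ∀ e → e ≢ x → e ∈ T
      others e e≢x with e ∈? T
      ... | yes e∈T = e∈T
      ... | no  e∉T = ⊥-elim (two-missing⇒disconnected e x e≢x e∉T x∉T connected)
      T≡ : T ≡ allBut x
      T≡ = ⊆-antisym (λ {e} e∈T → ∈-allBut λ { refl → x∉T e∈T })
                     (λ {e} e∈ → others e (∈-allBut⇒≢ e∈))
    ... | no ¬missing = ⊥-elim (acyclic fzero (all fzero) (Reach-sym cycle))
      where
      all : ∀ e → e ∈ T
      all e with e ∈? T
      ... | yes e∈T = e∈T
      ... | no  e∉T = ⊥-elim (¬missing (e , e∉T))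
      cycle : Reach (Minus T fzero) (nxt fzero) fzero
      cycle = reach-0-upwards (nxt fzero) λ e 1≤e → all e , λ { refl →
        ℕ.<-irrefl refl (ℕ.≤-trans (ℕ.≤-reflexive (sym (toℕ-nxt-< fzero 1≤m))) 1≤e) }

    tour-start : Current (suc m)
    tour-start = fzero , lo

    tourStep-tree-lo : ∀ {T : Subset (suc m)} {e} → lookup T e ≡ true → tourStep T (e , lo) ≡ (nxt e , lo)
    tourStep-tree-lo e∈T rewrite e∈T = refl

    tour-prefix : ∀ x j → j ℕ.≤ toℕ x → iter (tourStep (allBut x)) j tour-start ≡ (vertex j , lo)
    tour-prefix x zero    _       = refl
    tour-prefix x (suc j) 1+j≤x =
      trans (cong (tourStep (allBut x)) (tour-prefix x j (ℕ.≤-trans (ℕ.n≤1+n j) 1+j≤x)))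
            (trans (tourStep-tree-lo {T = allBut x} j∈) (cong (_, lo) (nxt-vertex j j<n)))
      where
      j<n : j ℕ.< suc m
      j<n = ℕ.≤-trans 1+j≤x (ℕ.≤-trans (toℕ≤pred[n] x) (ℕ.n≤1+n m))
      j∈ : lookup (allBut x) (vertex j) ≡ true
      j∈ = []=⇒lookup (∈-allBut λ j≡x → ℕ.<-irrefl (trans (sym (toℕ-vertex j j<n)) (cong toℕ j≡x)) 1+j≤x)

    tour-at-x : ∀ x → iter (tourStep (allBut x)) (toℕ x) tour-start ≡ (x , lo)
    tour-at-x x = trans (tour-prefix x (toℕ x) ℕ.≤-refl) (cong (_, lo) (vertex-toℕ x))

    JaegerCondition : Vec Ori (suc m) → Subset (suc m) → Set
    JaegerCondition G T = ∀ e → InG G e → e ∉ T →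
      Before T tour-start (e , tailEnd (lookup G e)) (e , headEnd (lookup G e))

    -- The only non-tree edge x is reached at (v_x, v_x v_{x+1}) before its
    -- other end, so the condition is that v_x is not its head.
    jaeger⇔not-bwd : ∀ G x → JaegerCondition G (allBut x) ⇔ (lookup G x ≢ bwd)
    jaeger⇔not-bwd G x = mk⇔ to from
      where
      to : JaegerCondition G (allBut x) → lookup G x ≢ bwd
      to jaeger x-bwd with jaeger x (λ x-none → bwd≢none (trans (sym x-bwd) x-none)) (∉-allBut x)
        where
        bwd≢none : bwd ≢ none
        bwd≢none ()
      ... | k , k-th , _ , head-unseen rewrite x-bwd with ℕ.≤-<-connex (toℕ x) k
      ... | inj₁ x≤k = head-unseen (toℕ x) x≤k (tour-at-x x)
      ... | inj₂ k<x with () ← cong proj₂ (trans (sym (tour-prefix x k (ℕ.<⇒≤ k<x))) k-th)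
      from : lookup G x ≢ bwd → JaegerCondition G (allBut x)
      from x-not-bwd e inG e∉ with e Fin.≟ x
      ... | no e≢x = ⊥-elim (e∉ (∈-allBut e≢x))
      ... | yes refl with lookup G e
      ...   | none = ⊥-elim (inG refl)
      ...   | bwd  = ⊥-elim (x-not-bwd refl)
      ...   | fwd  = toℕ e , tour-at-x e , no-return , head-unseen
        where
        no-return : ∀ j → 1 ℕ.≤ j → j ℕ.≤ toℕ e → iter (tourStep (allBut e)) j tour-start ≢ tour-start
        no-return j 1≤j j≤e returns with () ← subst (1 ℕ.≤_)
          (trans (sym (toℕ-vertex j (s≤s (ℕ.≤-trans j≤e (toℕ≤pred[n] e)))))
                 (cong (λ c → toℕ (proj₁ c)) (trans (sym (tour-prefix e j j≤e)) returns))) 1≤j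
        head-unseen : ∀ j → j ℕ.≤ toℕ e → iter (tourStep (allBut e)) j tour-start ≢ (e , hi)
        head-unseen j j≤e reached with () ← cong proj₂ (trans (sym (tour-prefix e j j≤e)) reached)

    OrientedTowards : Fin (suc m) → Vec Ori (suc m) → Fin (suc m) → Set
    OrientedTowards x G e = (toℕ e ℕ.< toℕ x × lookup G e ≡ fwd) ⊎ (toℕ x ℕ.< toℕ e × lookup G e ≡ bwd)

    -- In allBut x minus e, the component of v_0 is the side of e away from x.
    tailEdge⇔orientedTowards : ∀ G x e → AllOrientedBut x G →
      IsTailEdge G (allBut x) e ⇔ OrientedTowards x G e
    tailEdge⇔orientedTowards G x e oriented = mk⇔ to from
      where
      to : IsTailEdge G (allBut x) e → OrientedTowards x G e
      to (e∈ , r) with ℕ.<-cmp (toℕ e) (toℕ x) | lookup G e in G[e]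
      ... | tri≈ _ e≡x _ | _    = ⊥-elim (∈-allBut⇒≢ e∈ (toℕ-injective e≡x))
      ... | _            | none = ⊥-elim (oriented e (∈-allBut⇒≢ e∈) G[e])
      ... | tri< e<x _ _ | fwd  = inj₁ (e<x , refl)
      ... | tri> _ _ x<e | bwd  = inj₂ (x<e , refl)
      ... | tri< e<x _ _ | bwd  = ⊥-elim (ℕ.n≮0 (proj₁ (cut-below e<x r)))
      ... | tri> _ _ x<e | fwd  = ⊥-elim (ℕ.n≮0 (proj₁ (cut-above x<e r)))
      present : ∀ {f} → f ≢ x → f ≢ e → Minus (allBut x) e f
      present f≢x f≢e = ∈-allBut f≢x , f≢e
      from : OrientedTowards x G e → IsTailEdge G (allBut x) e
      from (inj₁ (e<x , G[e])) rewrite G[e] = ∈-allBut e≢x , reach-0-downwards e λ f f<e →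
        present (λ { refl → ℕ.<-asym f<e e<x }) (λ { refl → ℕ.<-irrefl refl f<e })
        where
        e≢x : e ≢ x
        e≢x refl = ℕ.<-irrefl refl e<x
      from (inj₂ (x<e , G[e])) rewrite G[e] = ∈-allBut e≢x , upper (ℕ.m≤n⇒m<n∨m≡n (toℕ≤pred[n] e))
        where
        e≢x : e ≢ x
        e≢x refl = ℕ.<-irrefl refl x<e
        upper : toℕ e ℕ.< m ⊎ toℕ e ≡ m → Reach (Minus (allBut x) e) (nxt e) fzero
        upper (inj₂ e≡m) = subst (Reach _ (nxt e)) (toℕ-injective (toℕ-nxt-last e e≡m)) here
        upper (inj₁ e<m) = reach-0-upwards (nxt e) λ f e+1≤f →
          let e<f = ℕ.≤-trans (ℕ.≤-reflexive (sym (toℕ-nxt-< e e<m))) e+1≤f in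
          present (λ { refl → ℕ.<-asym x<e e<f }) (λ { refl → ℕ.<-irrefl refl e<f })

module Characterisation where

  open BinomialSums using (Σ<; Σ<-suc)
  open CycleConnectivity
  open FacetGraphs
  open SpanningTrees
  open import Data.Nat as ℕ using (ℕ; zero; suc)
  import Data.Nat.Properties as ℕ
  open import Data.Fin using (Fin; toℕ) renaming (zero to fzero; suc to fsuc)
  open import Data.Fin.Subset using (Subset; _∈_; ∣_∣)
  open import Data.Fin.Subset.Properties using (⊆-antisym)
  open import Data.Vec as Vec using (Vec; lookup; tabulate)
  open import Data.Vec.Properties using ([]=⇒lookup; lookup⇒[]=; lookup∘tabulate)
  open import Data.Bool using (Bool; true; false)
  open import Relation.Binary.PropositionalEquality
  open import Relation.Nullary using (Dec; yes; no; does)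
  open import Relation.Nullary.Decidable using (_×-dec_; _⊎-dec_)
  open import Relation.Unary using (Decidable)
  open import Data.Empty using (⊥-elim)
  open import Data.Product using (Σ; _×_; _,_)
  open import Function.Bundles using (_⇔_; mk⇔; Equivalence)

  indicator : Bool → ℕ
  indicator true  = 1
  indicator false = 0

  module _ {n : ℕ} {Q : Fin n → Set} (Q? : Decidable Q) where

    subsetOf : Subset n
    subsetOf = tabulate (λ e → does (Q? e))

    ∈-subsetOf⇔ : ∀ e → e ∈ subsetOf ⇔ Q e
    ∈-subsetOf⇔ e = mk⇔ to from
      where
      to : e ∈ subsetOf → Q e
      to e∈ with Q? e | trans (sym ([]=⇒lookup e∈)) (lookup∘tabulate _ e)
      ... | yes q | _ = q
      from : Q e → e ∈ subsetOf
      from q = lookup⇒[]= e subsetOf (trans (lookup∘tabulate _ e) (does-yes (Q? e)))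
        where
        does-yes : (d : Dec (Q e)) → does d ≡ true
        does-yes (yes _) = refl
        does-yes (no ¬q) = ⊥-elim (¬q q)

    subsetOf-unique : (S : Subset n) → (∀ e → e ∈ S ⇔ Q e) → S ≡ subsetOf
    subsetOf-unique S S⇔Q = ⊆-antisym
      (λ {e} e∈S → Equivalence.from (∈-subsetOf⇔ e) (Equivalence.to (S⇔Q e) e∈S))
      (λ {e} e∈ → Equivalence.from (S⇔Q e) (Equivalence.to (∈-subsetOf⇔ e) e∈))

  ∣tabulate∣ : ∀ {n} (f : Fin n → Bool) (g : ℕ → Bool) → (∀ e → f e ≡ g (toℕ e)) →
    ∣ tabulate f ∣ ≡ Σ< n (λ k → indicator (g k))
  ∣tabulate∣ {zero}  f g f≡g = refl
  ∣tabulate∣ {suc n} f g f≡g = trans (∣∷∣ (f fzero) (f≡g fzero)) (sym (Σ<-suc n (λ k → indicator (g k))))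
    where
    tail : ∣ tabulate (λ e → f (fsuc e)) ∣ ≡ Σ< n (λ k → indicator (g (suc k)))
    tail = ∣tabulate∣ (λ e → f (fsuc e)) (λ k → g (suc k)) (λ e → f≡g (fsuc e))
    ∣∷∣ : ∀ b → b ≡ g 0 →
      ∣ b Vec.∷ tabulate (λ e → f (fsuc e)) ∣ ≡ indicator (g 0) ℕ.+ Σ< n (λ k → indicator (g (suc k)))
    ∣∷∣ true  b≡ rewrite sym b≡ = cong suc tail
    ∣∷∣ false b≡ rewrite sym b≡ = tail

  _≟ₒ_ : (a b : Ori) → Dec (a ≡ b)
  none ≟ₒ none = yes refl
  fwd  ≟ₒ fwd  = yes refl
  bwd  ≟ₒ bwd  = yes refl
  none ≟ₒ fwd  = no λ ()
  none ≟ₒ bwd  = no λ ()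
  fwd  ≟ₒ none = no λ ()
  fwd  ≟ₒ bwd  = no λ ()
  bwd  ≟ₒ none = no λ ()
  bwd  ≟ₒ fwd  = no λ ()

  module _ {m : ℕ} where

    orientedTowards? : ∀ x G → Decidable (OrientedTowards {m} x G)
    orientedTowards? x G e =
      ((toℕ e ℕ.<? toℕ x) ×-dec (lookup G e ≟ₒ fwd)) ⊎-dec ((toℕ x ℕ.<? toℕ e) ×-dec (lookup G e ≟ₒ bwd))

    towardsCount : Fin (suc m) → Vec Ori (suc m) → ℕ
    towardsCount x G = Σ< (suc m) (λ k → indicator (does (orientedTowards? x G (vertex k))))

    hasTailEdges⇔towardsCount : ∀ G x i → AllOrientedBut x G →
      HasTailEdges G (allBut x) i ⇔ (towardsCount x G ≡ i)
    hasTailEdges⇔towardsCount G x i oriented = mk⇔ to from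
      where
      tail⇔ : ∀ e → IsTailEdge G (allBut x) e ⇔ OrientedTowards x G e
      tail⇔ e = tailEdge⇔orientedTowards G x e oriented
      Q? = orientedTowards? x G
      S = subsetOf Q?
      ∣S∣ : ∣ S ∣ ≡ towardsCount x G
      ∣S∣ = ∣tabulate∣ _ _ (λ e → cong (λ v → does (orientedTowards? x G v)) (sym (vertex-toℕ e)))
      to : HasTailEdges G (allBut x) i → towardsCount x G ≡ i
      to (S′ , S′⇔ , ∣S′∣) = trans (sym ∣S∣) (trans (cong ∣_∣ (sym S′≡S)) ∣S′∣)
        where
        S′≡S : S′ ≡ S
        S′≡S = subsetOf-unique Q? S′ λ e → mk⇔
          (λ e∈ → Equivalence.to (tail⇔ e) (Equivalence.to (S′⇔ e) e∈))
          (λ t → Equivalence.from (S′⇔ e) (Equivalence.from (tail⇔ e) t))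
      from : towardsCount x G ≡ i → HasTailEdges G (allBut x) i
      from count≡i = S , (λ e → mk⇔
          (λ e∈ → Equivalence.from (tail⇔ e) (Equivalence.to (∈-subsetOf⇔ Q? e) e∈))
          (λ t → Equivalence.from (∈-subsetOf⇔ Q? e) (Equivalence.to (tail⇔ e) t)))
        , trans ∣S∣ count≡i

    Conditions : ℕ → Vec Ori (suc m) → Fin (suc m) → Set
    Conditions i G x = AllOrientedBut x G × lookup G x ≢ bwd × Balanced G × towardsCount x G ≡ i

    Characterised : ℕ → Vec Ori (suc m) × Subset (suc m) → Set
    Characterised i (G , T) = Σ (Fin (suc m)) λ x → T ≡ allBut x × Conditions i G x

    counted⇒characterised : 1 ℕ.≤ m → ∀ i G T → Counted (suc m) i (G , T) → Characterised i (G , T)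
    counted⇒characterised 1≤m i G T (facet , (tree , jaeger) , tails) with spanningTree⇒allBut 1≤m G T tree
    ... | x , refl , oriented =
      x , refl , oriented , Equivalence.to (jaeger⇔not-bwd G x) jaeger , facetGraph⇒balanced G facet ,
      Equivalence.to (hasTailEdges⇔towardsCount G x i oriented) tails

    characterised⇒counted : ∀ i G T → Characterised i (G , T) → Counted (suc m) i (G , T)
    characterised⇒counted i G .(allBut x) (x , refl , oriented , not-bwd , balanced , count) =
      balanced⇒facetGraph G x balanced oriented ,
      (allBut-isSpanningTree G x oriented , Equivalence.from (jaeger⇔not-bwd G x) not-bwd) ,
      Equivalence.from (hasTailEdges⇔towardsCount G x i oriented) count

module ListLemmas where

  open import Data.Nat using (_+_)
  open import Data.List using (List; []; _∷_; map; length; concatMap)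
  open import Data.List.Properties using (length-++)
  open import Data.Nat.ListAction using (sum)
  open import Data.List.Relation.Unary.Any using (here; there)
  open import Data.List.Relation.Unary.All as All using (_∷_)
  open import Data.List.Relation.Unary.AllPairs using ([]; _∷_)
  open import Data.List.Relation.Unary.Unique.Propositional using (Unique)
  import Data.List.Relation.Unary.Unique.Propositional.Properties as Unique
  open import Data.List.Membership.Propositional using (_∈_; find; lose)
  open import Data.List.Membership.Propositional.Properties using (∈-concatMap⁺; ∈-concatMap⁻; ∈-map⁻)
  open import Relation.Binary.PropositionalEquality
  open import Data.Product using (Σ; _×_; _,_)

  module _ {A B : Set} (f : A → List B) where

    ∈-concatMap⁺′ : ∀ {xs x y} → x ∈ xs → y ∈ f x → y ∈ concatMap f xs
    ∈-concatMap⁺′ x∈ y∈ = ∈-concatMap⁺ f (lose x∈ y∈)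

    ∈-concatMap⁻′ : ∀ xs {y} → y ∈ concatMap f xs → Σ A λ x → x ∈ xs × y ∈ f x
    ∈-concatMap⁻′ xs y∈ = find (∈-concatMap⁻ f {xs = xs} y∈)

    length-concatMap : ∀ xs → length (concatMap f xs) ≡ sum (map (λ x → length (f x)) xs)
    length-concatMap []       = refl
    length-concatMap (x ∷ xs) = trans (length-++ (f x)) (cong (length (f x) +_) (length-concatMap xs))

    concatMap-unique : ∀ xs → Unique xs → (∀ x → x ∈ xs → Unique (f x)) →
      (∀ x x′ y → x ∈ xs → x′ ∈ xs → y ∈ f x → y ∈ f x′ → x ≡ x′) → Unique (concatMap f xs)
    concatMap-unique []       _           _      _        = []
    concatMap-unique (x ∷ xs) (x∉ ∷ uniq) unique disjoint = Unique.++⁺ (unique x (here refl))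
      (concatMap-unique xs uniq (λ x′ x′∈ → unique x′ (there x′∈))
        (λ a b y a∈ b∈ → disjoint a b y (there a∈) (there b∈)))
      λ {y} (y∈fx , y∈rest) → let x′ , x′∈ , y∈fx′ = ∈-concatMap⁻′ xs y∈rest in
        All.lookup x∉ x′∈ (disjoint x x′ y (here refl) (there x′∈) y∈fx y∈fx′)

  map-unique : ∀ {A B : Set} (f : A → B) xs → Unique xs →
    (∀ a b → a ∈ xs → b ∈ xs → f a ≡ f b → a ≡ b) → Unique (map f xs)
  map-unique f []       _           _         = []
  map-unique f (x ∷ xs) (x∉ ∷ uniq) injective =
    All.tabulate fresh ∷ map-unique f xs uniq (λ a b a∈ b∈ → injective a b (there a∈) (there b∈))
    where
    fresh : ∀ {y} → y ∈ map f xs → f x ≢ y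
    fresh y∈ fx≡y with ∈-map⁻ f y∈
    ... | z , z∈ , refl = All.lookup x∉ z∈ (injective x z (here refl) (there z∈) fx≡y)

module Words where

  open BinomialSums using (_choose_)
  open FacetGraphs using (#fwd; #bwd)
  open import Data.Nat as ℕ using (ℕ; zero; suc; _+_)
  import Data.Nat.Properties as ℕ
  open import Data.List using (List; []; _∷_; _++_; map; length)
  open import Data.List.Properties using (length-++; length-map; ∷-injective; ∷-injectiveʳ)
  open import Data.List.Relation.Unary.Any using (here)
  open import Data.List.Relation.Unary.All using (All; []; _∷_)
  open import Data.List.Relation.Unary.AllPairs using ([]; _∷_)
  open import Data.List.Relation.Unary.Unique.Propositional using (Unique)
  import Data.List.Relation.Unary.Unique.Propositional.Properties as Unique
  open import Data.List.Membership.Propositional using (_∈_)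
  open import Data.List.Membership.Propositional.Properties using (∈-++⁺ˡ; ∈-++⁺ʳ; ∈-++⁻; ∈-map⁺; ∈-map⁻)
  open import Relation.Binary.PropositionalEquality
  open import Data.Empty using (⊥; ⊥-elim)
  open import Data.Sum using (_⊎_; inj₁; inj₂)
  open import Data.Product using (_×_; _,_; proj₁)
  open import Function.Bundles using (_⇔_; mk⇔)

  Oriented : Ori → Set
  Oriented o = o ≢ none

  tally : (Ori → ℕ) → List Ori → ℕ
  tally h []      = 0
  tally h (o ∷ w) = h o + tally h w

  tally-++ : ∀ h a (s : Ori) b → tally h (a ++ s ∷ b) ≡ tally h a + (h s + tally h b)
  tally-++ h []      s b = refl
  tally-++ h (o ∷ a) s b = trans (cong (h o +_) (tally-++ h a s b)) (sym (ℕ.+-assoc (h o) _ _))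

  tally-#fwd+#bwd : ∀ w → All Oriented w → tally #fwd w + tally #bwd w ≡ length w
  tally-#fwd+#bwd []          []         = refl
  tally-#fwd+#bwd (none ∷ w) (o≢ ∷ _)   = ⊥-elim (o≢ refl)
  tally-#fwd+#bwd (fwd ∷ w)  (_ ∷ all)  = cong suc (tally-#fwd+#bwd w all)
  tally-#fwd+#bwd (bwd ∷ w)  (_ ∷ all)  =
    trans (ℕ.+-suc (tally #fwd w) (tally #bwd w)) (cong suc (tally-#fwd+#bwd w all))

  data Direction : Set where
    forward backward : Direction

  along against : Direction → Ori
  along forward    = fwd
  along backward   = bwd
  against forward  = bwd
  against backward = fwd

  #along : Direction → Ori → ℕ
  #along forward  = #fwd
  #along backward = #bwd

  #along-along : ∀ d → #along d (along d) ≡ 1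
  #along-along forward  = refl
  #along-along backward = refl

  #along-against : ∀ d → #along d (against d) ≡ 0
  #along-against forward  = refl
  #along-against backward = refl

  along≢against : ∀ d → along d ≢ against d
  along≢against forward  ()
  along≢against backward ()

  along-or-against : ∀ d {o} → Oriented o → o ≡ along d ⊎ o ≡ against d
  along-or-against d        {none} o≢ = ⊥-elim (o≢ refl)
  along-or-against forward  {fwd}  _  = inj₁ refl
  along-or-against forward  {bwd}  _  = inj₂ refl
  along-or-against backward {fwd}  _  = inj₂ refl
  along-or-against backward {bwd}  _  = inj₁ refl

  oriented-along : ∀ d → Oriented (along d)
  oriented-along forward  ()
  oriented-along backward ()

  oriented-against : ∀ d → Oriented (against d)
  oriented-against forward  ()
  oriented-against backward ()

  words : Direction → ℕ → ℕ → List (List Ori)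
  words d zero    zero    = [] ∷ []
  words d zero    (suc k) = []
  words d (suc L) zero    = map (against d ∷_) (words d L zero)
  words d (suc L) (suc k) = map (along d ∷_) (words d L k) ++ map (against d ∷_) (words d L (suc k))

  IsWord : Direction → ℕ → ℕ → List Ori → Set
  IsWord d L k w = length w ≡ L × All Oriented w × tally (#along d) w ≡ k

  length-words : ∀ d L k → length (words d L k) ≡ L choose k
  length-words d zero    zero    = refl
  length-words d zero    (suc k) = refl
  length-words d (suc L) zero    = trans (length-map _ (words d L zero)) (length-words d L zero)
  length-words d (suc L) (suc k) = trans (length-++ (map (along d ∷_) (words d L k)))
    (cong₂ _+_ (trans (length-map _ (words d L k)) (length-words d L k))
               (trans (length-map _ (words d L (suc k))) (length-words d L (suc k))))

  words-unique : ∀ d L k → Unique (words d L k)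
  words-unique d zero    zero    = [] ∷ []
  words-unique d zero    (suc k) = []
  words-unique d (suc L) zero    = Unique.map⁺ ∷-injectiveʳ (words-unique d L zero)
  words-unique d (suc L) (suc k) = Unique.++⁺
    (Unique.map⁺ ∷-injectiveʳ (words-unique d L k))
    (Unique.map⁺ ∷-injectiveʳ (words-unique d L (suc k)))
    λ (w∈₁ , w∈₂) → disjoint w∈₁ w∈₂
    where
    disjoint : ∀ {w} → w ∈ map (along d ∷_) (words d L k) → w ∈ map (against d ∷_) (words d L (suc k)) → ⊥
    disjoint w∈₁ w∈₂ with ∈-map⁻ (along d ∷_) w∈₁ | ∈-map⁻ (against d ∷_) w∈₂
    ... | _ , _ , refl | _ , _ , eq = along≢against d (proj₁ (∷-injective eq))

  ∈-words⇔ : ∀ d L k w → w ∈ words d L k ⇔ IsWord d L k w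
  ∈-words⇔ d L k w = mk⇔ (to L k w) (from L k w)
    where
    to : ∀ L k w → w ∈ words d L k → IsWord d L k w
    to zero    zero    .[] (here refl) = refl , [] , refl
    to (suc L) zero    w   w∈ with ∈-map⁻ (against d ∷_) w∈
    ... | w′ , w′∈ , refl with to L zero w′ w′∈
    ... | len , all , tally≡ = cong suc len , oriented-against d ∷ all ,
      trans (cong (_+ tally (#along d) w′) (#along-against d)) tally≡
    to (suc L) (suc k) w   w∈ with ∈-++⁻ (map (along d ∷_) (words d L k)) w∈
    ... | inj₁ w∈₁ with ∈-map⁻ (along d ∷_) w∈₁
    ... | w′ , w′∈ , refl with to L k w′ w′∈
    ... | len , all , tally≡ = cong suc len , oriented-along d ∷ all ,
      trans (cong (_+ tally (#along d) w′) (#along-along d)) (cong suc tally≡)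
    to (suc L) (suc k) w w∈ | inj₂ w∈₂ with ∈-map⁻ (against d ∷_) w∈₂
    ... | w′ , w′∈ , refl with to L (suc k) w′ w′∈
    ... | len , all , tally≡ = cong suc len , oriented-against d ∷ all ,
      trans (cong (_+ tally (#along d) w′) (#along-against d)) tally≡
    from : ∀ L k w → IsWord d L k w → w ∈ words d L k
    from zero    zero    []      (refl , _ , _)  = here refl
    from zero    (suc k) []      (refl , _ , ())
    from (suc L) k       (o ∷ w) (len , o≢ ∷ all , tally≡) with along-or-against d o≢
    from (suc L) zero    (o ∷ w) (len , o≢ ∷ all , tally≡) | inj₁ refl
      with () ← trans (sym (cong (_+ tally (#along d) w) (#along-along d))) tally≡
    from (suc L) (suc k) (o ∷ w) (len , o≢ ∷ all , tally≡) | inj₁ refl =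
      ∈-++⁺ˡ (∈-map⁺ (along d ∷_) (from L k w (ℕ.suc-injective len , all ,
        ℕ.suc-injective (trans (cong (_+ tally (#along d) w) (sym (#along-along d))) tally≡))))
    from (suc L) zero    (o ∷ w) (len , o≢ ∷ all , tally≡) | inj₂ refl =
      ∈-map⁺ (against d ∷_) (from L zero w (ℕ.suc-injective len , all ,
        trans (cong (_+ tally (#along d) w) (sym (#along-against d))) tally≡))
    from (suc L) (suc k) (o ∷ w) (len , o≢ ∷ all , tally≡) | inj₂ refl =
      ∈-++⁺ʳ (map (along d ∷_) (words d L k)) (∈-map⁺ (against d ∷_) (from L (suc k) w (ℕ.suc-injective len , all ,
        trans (cong (_+ tally (#along d) w) (sym (#along-against d))) tally≡)))

  -- Balance forces the letter at the non-tree edge: absent for even m and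
  -- forward for odd m, where σ = m % 2.
  middleLetter : ℕ → Ori
  middleLetter zero    = none
  middleLetter (suc _) = fwd

  #fwd-middleLetter : ∀ σ → σ ℕ.≤ 1 → #fwd (middleLetter σ) ≡ σ
  #fwd-middleLetter zero          _        = refl
  #fwd-middleLetter (suc zero)    _        = refl
  #fwd-middleLetter (suc (suc _)) (ℕ.s≤s ())

  #bwd-middleLetter : ∀ σ → #bwd (middleLetter σ) ≡ 0
  #bwd-middleLetter zero    = refl
  #bwd-middleLetter (suc _) = refl

  middleLetter≢bwd : ∀ σ → middleLetter σ ≢ bwd
  middleLetter≢bwd zero    ()
  middleLetter≢bwd (suc _) ()

  #bwd-≢bwd : ∀ {o} → o ≢ bwd → #bwd o ≡ 0
  #bwd-≢bwd {none} _ = refl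
  #bwd-≢bwd {fwd}  _ = refl
  #bwd-≢bwd {bwd}  o≢ = ⊥-elim (o≢ refl)

  #fwd≤1 : ∀ o → #fwd o ℕ.≤ 1
  #fwd≤1 none = ℕ.z≤n
  #fwd≤1 fwd  = ℕ.s≤s ℕ.z≤n
  #fwd≤1 bwd  = ℕ.z≤n

  middleLetter-unique : ∀ {o} σ → o ≢ bwd → #fwd o ≡ σ → o ≡ middleLetter σ
  middleLetter-unique {none} _ _  refl = refl
  middleLetter-unique {fwd}  _ _  refl = refl
  middleLetter-unique {bwd}  _ o≢ _    = ⊥-elim (o≢ refl)

module WordEncoding where

  open BinomialSums using (Σ<; Σ<-cong; Σ<-suc; Σ<-+)
  open CycleConnectivity using (vertex; toℕ-vertex; vertex-toℕ)
  open FacetGraphs using (#fwd; #bwd; orientationAt; Balanced; AllOrientedBut)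
  open SpanningTrees using (OrientedTowards)
  open Characterisation using (indicator; orientedTowards?; towardsCount; Conditions)
  open Words using (tally; Oriented)
  open import Data.Nat as ℕ using (ℕ; zero; suc; s≤s; z≤n; _+_; _∸_)
  import Data.Nat.Properties as ℕ
  open import Data.Fin using (Fin; toℕ)
  open import Data.Fin.Properties using (toℕ<n)
  open import Data.Vec using (Vec; lookup; tabulate)
  open import Data.Vec.Properties using (lookup∘tabulate; tabulate∘lookup; tabulate-cong)
  open import Data.List using (List; []; _∷_; _++_; length; applyUpTo; take; drop)
  open import Data.List.Properties using (∷-injective; length-++; length-applyUpTo)
  open import Data.List.Relation.Unary.All using (All; []; _∷_)
  open import Relation.Binary.PropositionalEquality
  open import Relation.Nullary using (¬_; Dec; yes; no; does)
  open import Data.Empty using (⊥-elim)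
  open import Data.Sum using (inj₁; inj₂)
  open import Data.Product using (Σ; _×_; _,_)
  open import Function.Bundles using (_⇔_; mk⇔; Equivalence)
  open import Relation.Binary.Definitions using (tri<; tri≈; tri>)

  -- Positions past the end of the word read as the junk letter none.
  at : List Ori → ℕ → Ori
  at []      _       = none
  at (o ∷ w) zero    = o
  at (o ∷ w) (suc k) = at w k

  at-++ˡ : ∀ a r k → k ℕ.< length a → at (a ++ r) k ≡ at a k
  at-++ˡ (o ∷ a) r zero    _         = refl
  at-++ˡ (o ∷ a) r (suc k) (s≤s k<a) = at-++ˡ a r k k<a

  at-++ʳ : ∀ a r k → at (a ++ r) (length a + k) ≡ at r k
  at-++ʳ []      r k = refl
  at-++ʳ (o ∷ a) r k = at-++ʳ a r k

  at-middle : ∀ a (s : Ori) b → at (a ++ s ∷ b) (length a) ≡ s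
  at-middle a s b = trans (cong (at (a ++ s ∷ b)) (sym (ℕ.+-identityʳ (length a)))) (at-++ʳ a (s ∷ b) 0)

  at-suffix : ∀ a (s : Ori) b k → length a ℕ.< k → k ℕ.< length a + suc (length b) →
    Σ ℕ λ j → j ℕ.< length b × at (a ++ s ∷ b) k ≡ at b j
  at-suffix a s b k a<k k<len = j , j<b , trans (cong (at (a ++ s ∷ b)) (sym a+1+j≡k)) (at-++ʳ a (s ∷ b) (suc j))
    where
    j = k ∸ suc (length a)
    a+1+j≡k : length a + suc j ≡ k
    a+1+j≡k = trans (ℕ.+-suc (length a) j) (ℕ.m+[n∸m]≡n a<k)
    j<b : j ℕ.< length b
    j<b = ℕ.≤-pred (ℕ.+-cancelˡ-< (length a) (suc j) (suc (length b))
      (subst (ℕ._< length a + suc (length b)) (sym a+1+j≡k) k<len))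

  at-applyUpTo : ∀ (f : ℕ → Ori) L k → k ℕ.< L → at (applyUpTo f L) k ≡ f k
  at-applyUpTo f (suc L) zero    _         = refl
  at-applyUpTo f (suc L) (suc k) (s≤s k<L) = at-applyUpTo (λ j → f (suc j)) L k k<L

  at-extensional : ∀ w w′ → length w ≡ length w′ →
    (∀ k → k ℕ.< length w → at w k ≡ at w′ k) → w ≡ w′
  at-extensional []      []       _   _    = refl
  at-extensional (o ∷ w) (o′ ∷ w′) len same = cong₂ _∷_ (same 0 (s≤s z≤n))
    (at-extensional w w′ (ℕ.suc-injective len) (λ k k<w → same (suc k) (s≤s k<w)))

  All-at : ∀ (P : Ori → Set) w k → k ℕ.< length w → All P w → P (at w k)
  All-at P (o ∷ w) zero    _         (p ∷ _)   = p
  All-at P (o ∷ w) (suc k) (s≤s k<w) (_ ∷ all) = All-at P w k k<w all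

  at-All : ∀ (P : Ori → Set) w → (∀ k → k ℕ.< length w → P (at w k)) → All P w
  at-All P []      _     = []
  at-All P (o ∷ w) every = every 0 (s≤s z≤n) ∷ at-All P w (λ k k<w → every (suc k) (s≤s k<w))

  Σ<-at : ∀ (h : Ori → ℕ) w → Σ< (length w) (λ k → h (at w k)) ≡ tally h w
  Σ<-at h []      = refl
  Σ<-at h (o ∷ w) = trans (Σ<-suc (length w) (λ k → h (at (o ∷ w) k))) (cong (h o +_) (Σ<-at h w))

  split-at : ∀ w c → c ℕ.< length w → w ≡ take c w ++ at w c ∷ drop (suc c) w
  split-at (o ∷ w) zero    _         = refl
  split-at (o ∷ w) (suc c) (s≤s c<w) = cong (o ∷_) (split-at w c c<w)

  length-take-≤ : ∀ (w : List Ori) c → c ℕ.≤ length w → length (take c w) ≡ c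
  length-take-≤ w       zero    _         = refl
  length-take-≤ (o ∷ w) (suc c) (s≤s c≤w) = cong suc (length-take-≤ w c c≤w)

  ++-∷-cancel : ∀ a a′ (s s′ : Ori) b b′ → length a ≡ length a′ →
    a ++ s ∷ b ≡ a′ ++ s′ ∷ b′ → a ≡ a′ × b ≡ b′
  ++-∷-cancel []      []       s s′ b b′ _   refl = refl , refl
  ++-∷-cancel (o ∷ a) (o′ ∷ a′) s s′ b b′ len eq with ∷-injective eq
  ... | refl , eq′ with ++-∷-cancel a a′ s s′ b b′ (ℕ.suc-injective len) eq′
  ... | refl , refl = refl , refl

  module _ {m : ℕ} where

    fromWord : List Ori → Vec Ori (suc m)
    fromWord w = tabulate (λ e → at w (toℕ e))

    toWord : Vec Ori (suc m) → List Ori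
    toWord G = applyUpTo (orientationAt G) (suc m)

    orientationAt-fromWord : ∀ w k → k ℕ.< suc m → orientationAt (fromWord w) k ≡ at w k
    orientationAt-fromWord w k k<n =
      trans (lookup∘tabulate (λ e → at w (toℕ e)) (vertex k)) (cong (at w) (toℕ-vertex k k<n))

    fromWord-injective : ∀ w w′ → length w ≡ suc m → length w′ ≡ suc m →
      fromWord w ≡ fromWord w′ → w ≡ w′
    fromWord-injective w w′ len len′ eq = at-extensional w w′ (trans len (sym len′)) λ k k<w →
      let k<n = subst (k ℕ.<_) len k<w in
      trans (sym (orientationAt-fromWord w k k<n))
        (trans (cong (λ G → orientationAt G k) eq) (orientationAt-fromWord w′ k k<n))

    fromWord-toWord : ∀ G → fromWord (toWord G) ≡ G
    fromWord-toWord G = trans (tabulate-cong λ e →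
        trans (at-applyUpTo (orientationAt G) (suc m) (toℕ e) (toℕ<n e)) (cong (lookup G) (vertex-toℕ e)))
      (tabulate∘lookup G)

    Σ<-fromWord : ∀ (h : Ori → ℕ) w → length w ≡ suc m →
      Σ< (suc m) (λ k → h (orientationAt (fromWord w) k)) ≡ tally h w
    Σ<-fromWord h w len = trans (Σ<-cong (suc m) (λ k k<n → cong h (orientationAt-fromWord w k k<n)))
      (trans (cong (λ L → Σ< L (λ k → h (at w k))) (sym len)) (Σ<-at h w))

    balanced-fromWord : ∀ w → length w ≡ suc m → tally #fwd w ≡ tally #bwd w → Balanced (fromWord w)
    balanced-fromWord w len balanced = trans (Σ<-fromWord #fwd w len) (trans balanced (sym (Σ<-fromWord #bwd w len)))

    fromWord-balanced : ∀ w → length w ≡ suc m → Balanced (fromWord w) → tally #fwd w ≡ tally #bwd w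
    fromWord-balanced w len balanced = trans (sym (Σ<-fromWord #fwd w len)) (trans balanced (Σ<-fromWord #bwd w len))

    private
      indicator-yes : ∀ {P : Set} (d : Dec P) → P → indicator (does d) ≡ 1
      indicator-yes (yes _) _ = refl
      indicator-yes (no ¬p) p = ⊥-elim (¬p p)

      indicator-no : ∀ {P : Set} (d : Dec P) → ¬ P → indicator (does d) ≡ 0
      indicator-no (yes p) ¬p = ⊥-elim (¬p p)
      indicator-no (no _)  _  = refl

    towards-below : ∀ x G e → toℕ e ℕ.< toℕ x → indicator (does (orientedTowards? {m} x G e)) ≡ #fwd (lookup G e)
    towards-below x G e e<x = below (orientedTowards? x G e)
      where
      below : (d : Dec (OrientedTowards x G e)) → indicator (does d) ≡ #fwd (lookup G e)
      below d with lookup G e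
      ... | fwd  = indicator-yes d (inj₁ (e<x , refl))
      ... | none = indicator-no d λ { (inj₁ (_ , ())) ; (inj₂ (x<e , _)) → ℕ.<-asym e<x x<e }
      ... | bwd  = indicator-no d λ { (inj₁ (_ , ())) ; (inj₂ (x<e , _)) → ℕ.<-asym e<x x<e }

    towards-above : ∀ x G e → toℕ x ℕ.< toℕ e → indicator (does (orientedTowards? {m} x G e)) ≡ #bwd (lookup G e)
    towards-above x G e x<e = above (orientedTowards? x G e)
      where
      above : (d : Dec (OrientedTowards x G e)) → indicator (does d) ≡ #bwd (lookup G e)
      above d with lookup G e
      ... | bwd  = indicator-yes d (inj₂ (x<e , refl))
      ... | none = indicator-no d λ { (inj₂ (_ , ())) ; (inj₁ (e<x , _)) → ℕ.<-asym e<x x<e }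
      ... | fwd  = indicator-no d λ { (inj₂ (_ , ())) ; (inj₁ (e<x , _)) → ℕ.<-asym e<x x<e }

    towards-at : ∀ x G → indicator (does (orientedTowards? {m} x G x)) ≡ 0
    towards-at x G = indicator-no (orientedTowards? x G x) λ
      { (inj₁ (x<x , _)) → ℕ.<-irrefl refl x<x ; (inj₂ (x<x , _)) → ℕ.<-irrefl refl x<x }

    towardsCount-fromWord : ∀ a s b → length a + suc (length b) ≡ suc m →
      towardsCount (vertex (length a)) (fromWord (a ++ s ∷ b)) ≡ tally #fwd a + tally #bwd b
    towardsCount-fromWord a s b len = begin
      Σ< (suc m) f                              ≡⟨ cong (λ L → Σ< L f) (sym len) ⟩
      Σ< (c + suc r) f                          ≡⟨ Σ<-+ c (suc r) f ⟩
      Σ< c f + Σ< (suc r) (λ k → f (c + k))     ≡⟨ cong₂ _+_ prefix (Σ<-suc r (λ k → f (c + k))) ⟩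
      tally #fwd a + (f (c + 0) + Σ< r (λ k → f (c + suc k)))
                                                ≡⟨ cong (tally #fwd a +_) (cong₂ _+_ middle suffix) ⟩
      tally #fwd a + (0 + tally #bwd b)         ∎
      where
      open ≡-Reasoning
      c = length a
      r = length b
      w = a ++ s ∷ b
      G = fromWord w
      x = vertex {m} c
      f : ℕ → ℕ
      f k = indicator (does (orientedTowards? x G (vertex k)))
      c<n : c ℕ.< suc m
      c<n = subst (c ℕ.<_) len (ℕ.≤-trans (s≤s (ℕ.m≤m+n c r)) (ℕ.≤-reflexive (sym (ℕ.+-suc c r))))
      x≡c : toℕ x ≡ c
      x≡c = toℕ-vertex c c<n
      prefix : Σ< c f ≡ tally #fwd a
      prefix = trans (Σ<-cong c λ k k<c → let k<n = ℕ.<-trans k<c c<n in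
          trans (towards-below x G (vertex k) (subst₂ ℕ._<_ (sym (toℕ-vertex k k<n)) (sym x≡c) k<c))
                (cong #fwd (trans (orientationAt-fromWord w k k<n) (at-++ˡ a (s ∷ b) k k<c))))
        (Σ<-at #fwd a)
      middle : f (c + 0) ≡ 0
      middle = trans (cong (λ k → f k) (ℕ.+-identityʳ c)) (towards-at x G)
      suffix : Σ< r (λ k → f (c + suc k)) ≡ tally #bwd b
      suffix = trans (Σ<-cong r λ k k<r → let j<n = subst (c + suc k ℕ.<_) len (ℕ.+-monoʳ-< c (s≤s k<r)) in
          trans (towards-above x G (vertex (c + suc k)) (subst₂ ℕ._<_ (sym x≡c) (sym (toℕ-vertex (c + suc k) j<n))
                   (ℕ.≤-trans (s≤s (ℕ.m≤m+n c k)) (ℕ.≤-reflexive (sym (ℕ.+-suc c k))))))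
                (cong #bwd (trans (orientationAt-fromWord w (c + suc k) j<n) (at-++ʳ a (s ∷ b) (suc k)))))
        (Σ<-at #bwd b)

    WordConditions : ℕ → List Ori → Ori → List Ori → Set
    WordConditions i a s b = All Oriented a × All Oriented b × s ≢ bwd ×
      tally #fwd (a ++ s ∷ b) ≡ tally #bwd (a ++ s ∷ b) × tally #fwd a + tally #bwd b ≡ i

    module _ (a : List Ori) (s : Ori) (b : List Ori) (len : length a + suc (length b) ≡ suc m) where

      private
        w = a ++ s ∷ b
        G = fromWord w
        x = vertex {m} (length a)
        lenw : length w ≡ suc m
        lenw = trans (length-++ a) len
        a<n : length a ℕ.< suc m
        a<n = subst (length a ℕ.<_) len (ℕ.≤-trans (s≤s (ℕ.m≤m+n _ _)) (ℕ.≤-reflexive (sym (ℕ.+-suc _ _))))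
        x≡a : toℕ x ≡ length a
        x≡a = toℕ-vertex (length a) a<n
        lookup-fromWord : ∀ e → lookup G e ≡ at w (toℕ e)
        lookup-fromWord e = lookup∘tabulate (λ e → at w (toℕ e)) e
        lookup-at-vertex : ∀ k → k ℕ.< suc m → lookup G (vertex k) ≡ at w k
        lookup-at-vertex k k<n = trans (lookup-fromWord (vertex k)) (cong (at w) (toℕ-vertex k k<n))
        vertex≢x : ∀ k → k ℕ.< suc m → k ≢ length a → vertex k ≢ x
        vertex≢x k k<n k≢a vk≡x = k≢a (trans (sym (toℕ-vertex k k<n)) (trans (cong toℕ vk≡x) x≡a))

      fromWord-middle : lookup G x ≡ s
      fromWord-middle = trans (lookup-fromWord x) (trans (cong (at w) x≡a) (at-middle a s b))

      fromWord-oriented⇔ : AllOrientedBut x G ⇔ (All Oriented a × All Oriented b)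
      fromWord-oriented⇔ = mk⇔ to from
        where
        to : AllOrientedBut x G → All Oriented a × All Oriented b
        to oriented = at-All Oriented a prefix , at-All Oriented b suffix
          where
          prefix : ∀ k → k ℕ.< length a → Oriented (at a k)
          prefix k k<a = let k<n = ℕ.<-trans k<a a<n in
            subst Oriented (trans (lookup-at-vertex k k<n) (at-++ˡ a (s ∷ b) k k<a))
              (oriented (vertex k) (vertex≢x k k<n (ℕ.<⇒≢ k<a)))
          suffix : ∀ j → j ℕ.< length b → Oriented (at b j)
          suffix j j<b = let k = length a + suc j
                             k<n = subst (k ℕ.<_) len (ℕ.+-monoʳ-< (length a) (s≤s j<b)) in
            subst Oriented (trans (lookup-at-vertex k k<n) (at-++ʳ a (s ∷ b) (suc j)))
              (oriented (vertex k) (vertex≢x k k<n (ℕ.m+1+n≢m (length a))))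
        from : All Oriented a × All Oriented b → AllOrientedBut x G
        from (all-a , all-b) e e≢x rewrite lookup-fromWord e with ℕ.<-cmp (toℕ e) (length a)
        ... | tri< e<a _ _ = subst Oriented (sym (at-++ˡ a (s ∷ b) (toℕ e) e<a)) (All-at Oriented a (toℕ e) e<a all-a)
        ... | tri≈ _ e≡a _ = ⊥-elim (e≢x (trans (sym (vertex-toℕ e)) (cong vertex e≡a)))
        ... | tri> _ _ a<e with at-suffix a s b (toℕ e) a<e (subst (toℕ e ℕ.<_) (sym len) (toℕ<n e))
        ...   | j , j<b , at≡ = subst Oriented (sym at≡) (All-at Oriented b j j<b all-b)

      conditions⇔wordConditions : ∀ i → Conditions i G x ⇔ WordConditions i a s b
      conditions⇔wordConditions i = mk⇔
        (λ (oriented , not-bwd , balanced , towards) →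
          let all-a , all-b = Equivalence.to fromWord-oriented⇔ oriented in
          all-a , all-b , subst (_≢ bwd) fromWord-middle not-bwd , fromWord-balanced w lenw balanced ,
          trans (sym (towardsCount-fromWord a s b len)) towards)
        (λ (all-a , all-b , not-bwd , balanced , towards) →
          Equivalence.from fromWord-oriented⇔ (all-a , all-b) , subst (_≢ bwd) (sym fromWord-middle) not-bwd ,
          balanced-fromWord w lenw balanced , trans (towardsCount-fromWord a s b len) towards)

    toWord-split : ∀ G (x : Fin (suc m)) → Σ (List Ori) λ a → Σ (List Ori) λ b →
      length a ≡ toℕ x × length a + suc (length b) ≡ suc m × G ≡ fromWord (a ++ lookup G x ∷ b)
    toWord-split G x = take c w , drop (suc c) w , length-take-≤ w c (ℕ.<⇒≤ c<w) ,
      trans (sym (length-++ (take c w))) (trans (cong length (sym w≡)) lenw) ,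
      trans (sym (fromWord-toWord G)) (cong fromWord w≡)
      where
      w = toWord G
      c = toℕ x
      lenw : length w ≡ suc m
      lenw = length-applyUpTo (orientationAt G) (suc m)
      c<w : c ℕ.< length w
      c<w = subst (c ℕ.<_) (sym lenw) (toℕ<n x)
      at≡ : at w c ≡ lookup G x
      at≡ = trans (at-applyUpTo (orientationAt G) (suc m) c (toℕ<n x)) (cong (lookup G) (vertex-toℕ x))
      w≡ : w ≡ take c w ++ lookup G x ∷ drop (suc c) w
      w≡ = trans (split-at w c c<w) (cong (λ s → take c w ++ s ∷ drop (suc c) w) at≡)

module CountingArithmetic where

  open import Data.Nat
  open import Data.Nat.Properties
  open import Data.Nat.Tactic.RingSolver using (solve-∀)
  open import Relation.Binary.PropositionalEquality
  open import Data.Empty using (⊥-elim)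
  open import Data.Product using (_×_; _,_; proj₁; proj₂)

  equal-parity : ∀ s t X Y → s ≤ 1 → t ≤ 1 → s + t + 2 * X ≡ 2 * Y → s ≡ t × t + X ≡ Y
  equal-parity 0 0 X Y _ _ eq = refl , *-cancelˡ-≡ X Y 2 eq
  equal-parity 1 1 X Y _ _ eq = refl , *-cancelˡ-≡ (suc X) Y 2 (trans (*-distribˡ-+ 2 1 X) eq)
  equal-parity 0 1 X Y _ _ eq = ⊥-elim (even≢odd Y X (sym eq))
  equal-parity 1 0 X Y _ _ eq = ⊥-elim (even≢odd Y X (sym eq))
  equal-parity (suc (suc _)) _ X Y (s≤s ()) _ _
  equal-parity _ (suc (suc _)) X Y _ (s≤s ()) _

  -- With m = σ + 2h, a tree whose non-tree edge is preceded by p forward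
  -- edges and followed by i - p backward ones has it at position 2p + offset.
  offset : (h σ i : ℕ) → ℕ
  offset h σ i = (h + σ) ∸ i

  2i+offset≤m : ∀ m h σ i → m ≡ σ + h * 2 → i ≤ h → 2 * i + offset h σ i ≤ m
  2i+offset≤m m h σ i m≡ i≤h = begin
    2 * i + D        ≡⟨ shape₁ i D ⟩
    i + (D + i)      ≡⟨ cong (i +_) (m∸n+n≡m (≤-trans i≤h (m≤m+n h σ))) ⟩
    i + (h + σ)      ≤⟨ +-monoˡ-≤ (h + σ) i≤h ⟩
    h + (h + σ)      ≡⟨ trans (shape₂ h σ) (sym m≡) ⟩
    m                ∎
    where
    open ≤-Reasoning
    D = offset h σ i
    shape₁ : ∀ i D → 2 * i + D ≡ i + (D + i)
    shape₁ = solve-∀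
    shape₂ : ∀ h σ → h + (h + σ) ≡ σ + h * 2
    shape₂ = solve-∀

  2p+offset≤m : ∀ m h σ i p → m ≡ σ + h * 2 → i ≤ h → p ≤ i → 2 * p + offset h σ i ≤ m
  2p+offset≤m m h σ i p m≡ i≤h p≤i =
    ≤-trans (+-monoˡ-≤ (offset h σ i) (*-monoʳ-≤ 2 p≤i)) (2i+offset≤m m h σ i m≡ i≤h)

  -- Word a (p forward, aB backward letters), middle letter with sF forward
  -- letters, word b (bF forward, Q backward letters).
  balanced⇒shape : ∀ m h σ i c r p Q aB bF sF →
    m ≡ σ + h * 2 → σ ≤ 1 → sF ≤ 1 → i ≤ h →
    p + aB ≡ c → bF + Q ≡ r → c + suc r ≡ suc m → p + Q ≡ i →
    p + (sF + bF) ≡ aB + (0 + Q) →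
    sF ≡ σ × c ≡ 2 * p + offset h σ i
  balanced⇒shape m h σ i c r p Q aB bF sF m≡ σ≤1 sF≤1 i≤h a≡ b≡ len towards balanced = sF≡σ , c≡
    where
    m≡a+b : σ + h * 2 ≡ (p + aB) + (bF + Q)
    m≡a+b = trans (sym m≡) (trans (sym (suc-injective (trans (sym (+-suc c r)) len))) (cong₂ _+_ (sym a≡) (sym b≡)))
    doubled : sF + σ + 2 * (2 * p + h) ≡ 2 * (c + i)
    doubled = begin
      sF + σ + 2 * (2 * p + h)                ≡⟨ shape₁ sF σ p h ⟩
      4 * p + sF + (σ + h * 2)                ≡⟨ cong (4 * p + sF +_) m≡a+b ⟩
      4 * p + sF + ((p + aB) + (bF + Q))      ≡⟨ shape₂ p sF aB bF Q ⟩
      4 * p + aB + Q + (p + (sF + bF))        ≡⟨ cong (4 * p + aB + Q +_) balanced ⟩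
      4 * p + aB + Q + (aB + (0 + Q))         ≡⟨ shape₃ p aB Q ⟩
      2 * ((p + aB) + (p + Q))                ≡⟨ cong (2 *_) (cong₂ _+_ a≡ towards) ⟩
      2 * (c + i)                             ∎
      where
      open ≡-Reasoning
      shape₁ : ∀ sF σ p h → sF + σ + 2 * (2 * p + h) ≡ 4 * p + sF + (σ + h * 2)
      shape₁ = solve-∀
      shape₂ : ∀ p sF aB bF Q → 4 * p + sF + ((p + aB) + (bF + Q)) ≡ 4 * p + aB + Q + (p + (sF + bF))
      shape₂ = solve-∀
      shape₃ : ∀ p aB Q → 4 * p + aB + Q + (aB + (0 + Q)) ≡ 2 * ((p + aB) + (p + Q))
      shape₃ = solve-∀
    sameParity : sF ≡ σ × σ + (2 * p + h) ≡ c + i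
    sameParity = equal-parity sF σ (2 * p + h) (c + i) sF≤1 σ≤1 doubled
    sF≡σ : sF ≡ σ
    sF≡σ = proj₁ sameParity
    c+i≡ : c + i ≡ 2 * p + (h + σ)
    c+i≡ = trans (sym (proj₂ sameParity)) (shape σ p h)
      where
      shape : ∀ σ p h → σ + (2 * p + h) ≡ 2 * p + (h + σ)
      shape = solve-∀
    c≡ : c ≡ 2 * p + offset h σ i
    c≡ = trans (sym (m+n∸n≡m c i)) (trans (cong (_∸ i) c+i≡) (+-∸-assoc (2 * p) (≤-trans i≤h (m≤m+n h σ))))

  shape⇒balanced : ∀ m h σ i p aB bF r → m ≡ σ + h * 2 → i ≤ h → p ≤ i →
    p + aB ≡ 2 * p + offset h σ i → bF + (i ∸ p) ≡ r → r ≡ m ∸ (2 * p + offset h σ i) →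
    p + (σ + bF) ≡ aB + (0 + (i ∸ p))
  shape⇒balanced m h σ i p aB bF r m≡ i≤h p≤i a≡ b≡ r≡ =
    trans (cong (p +_) σ+bF≡D+Q) (trans (sym (+-assoc p D Q)) (cong (_+ Q) (sym aB≡p+D)))
    where
    D = offset h σ i
    Q = i ∸ p
    c = 2 * p + D
    aB≡p+D : aB ≡ p + D
    aB≡p+D = +-cancelˡ-≡ p aB (p + D) (trans a≡ (shape p D))
      where
      shape : ∀ p D → 2 * p + D ≡ p + (p + D)
      shape = solve-∀
    σ+bF≡D+Q : σ + bF ≡ D + Q
    σ+bF≡D+Q = +-cancelˡ-≡ (c + Q) (σ + bF) (D + Q) (begin
      (c + Q) + (σ + bF)     ≡⟨ shape₁ p D Q σ bF ⟩
      σ + (c + (bF + Q))     ≡⟨ cong (λ z → σ + (c + z)) b≡ ⟩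
      σ + (c + r)            ≡⟨ cong (σ +_) (trans (trans (cong (c +_) r≡) (m+[n∸m]≡n c≤m)) m≡) ⟩
      σ + (σ + h * 2)        ≡⟨ shape₂ h σ ⟩
      2 * (h + σ)            ≡⟨ cong (2 *_) (sym (m∸n+n≡m (≤-trans i≤h (m≤m+n h σ)))) ⟩
      2 * (D + i)            ≡⟨ cong (λ z → 2 * (D + z)) (sym (m+[n∸m]≡n p≤i)) ⟩
      2 * (D + (p + Q))      ≡⟨ shape₃ p D Q ⟩
      (c + Q) + (D + Q)      ∎)
      where
      open ≡-Reasoning
      c≤m : c ≤ m
      c≤m = 2p+offset≤m m h σ i p m≡ i≤h p≤i
      shape₁ : ∀ p D Q σ bF → (2 * p + D + Q) + (σ + bF) ≡ σ + ((2 * p + D) + (bF + Q))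
      shape₁ = solve-∀
      shape₂ : ∀ h σ → σ + (σ + h * 2) ≡ 2 * (h + σ)
      shape₂ = solve-∀
      shape₃ : ∀ p D Q → 2 * (D + (p + Q)) ≡ (2 * p + D + Q) + (D + Q)
      shape₃ = solve-∀

module Enumeration (m i : ℕ) (1≤m : 1 ≤ m) (i≤h : i ≤ m / 2) where

  open import Data.Nat as ℕ using (ℕ; suc; s≤s; _+_; _*_; _∸_)
  open import Data.Nat.DivMod using (_/_; _%_; m≡m%n+[m/n]*n; m%n<n)


  open BinomialSums
  open CycleConnectivity using (vertex; toℕ-vertex; vertex-toℕ)
  open FacetGraphs using (#fwd; #bwd)
  open SpanningTrees using (allBut; allBut-injective)
  open Characterisation
  open ListLemmas
  open Words
  open WordEncoding
  open CountingArithmetic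
  import Data.Nat.Properties as ℕ
  open import Data.Nat.Combinatorics using (_C_)
  open import Data.Fin using (toℕ)
  open import Data.Fin.Subset using (Subset)
  open import Data.Vec using (Vec; lookup)
  open import Data.List using (List; []; _∷_; _++_; map; length; upTo; concatMap)
  open import Data.List.Properties using (length-map; length-++)
  open import Data.Nat.ListAction using (sum)
  open import Data.List.Relation.Unary.Unique.Propositional using (Unique)
  open import Data.List.Relation.Unary.Unique.Propositional.Properties using (upTo⁺)
  open import Data.List.Membership.Propositional using (_∈_)
  open import Data.List.Membership.Propositional.Properties using (∈-map⁺; ∈-map⁻; ∈-upTo⁺; ∈-upTo⁻)
  open import Relation.Binary.PropositionalEquality
  open import Data.Product using (Σ; _×_; _,_; proj₁; proj₂)
  open import Function.Bundles using (_⇔_; mk⇔; Equivalence)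

  h σ : ℕ
  h = m / 2
  σ = m % 2

  m≡σ+2h : m ≡ σ + h * 2
  m≡σ+2h = m≡m%n+[m/n]*n m 2

  σ≤1 : σ ℕ.≤ 1
  σ≤1 = ℕ.≤-pred (m%n<n m 2)

  D : ℕ
  D = offset h σ i

  prefixLength suffixLength : ℕ → ℕ
  prefixLength p = 2 * p + D
  suffixLength p = m ∸ prefixLength p

  prefixLength≤m : ∀ {p} → p ℕ.≤ i → prefixLength p ℕ.≤ m
  prefixLength≤m {p} p≤i = 2p+offset≤m m h σ i p m≡σ+2h i≤h p≤i

  word-length : ∀ {p} (a b : List Ori) → p ℕ.≤ i → length a ≡ prefixLength p → length b ≡ suffixLength p →
    length a + suc (length b) ≡ suc m
  word-length {p} a b p≤i a≡ b≡ = trans (cong₂ (λ x y → x + suc y) a≡ b≡)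
    (trans (ℕ.+-suc (prefixLength p) (suffixLength p)) (cong suc (ℕ.m+[n∸m]≡n (prefixLength≤m p≤i))))

  prefixes suffixes : ℕ → List (List Ori)
  prefixes p = words forward (prefixLength p) p
  suffixes p = words backward (suffixLength p) (i ∸ p)

  Pair : Set
  Pair = Vec Ori (suc m) × Subset (suc m)

  encode : ℕ → List Ori → List Ori → Pair
  encode p a b = fromWord (a ++ middleLetter σ ∷ b) , allBut (vertex (prefixLength p))

  candidates : ℕ → List Pair
  candidates p = concatMap (λ a → map (encode p a) (suffixes p)) (prefixes p)

  enumeration : List Pair
  enumeration = concatMap candidates (upTo (suc i))

  length-candidates : ∀ p → length (candidates p) ≡ binomialTerm D m i p
  length-candidates p = begin
    length (candidates p)
      ≡⟨ length-concatMap _ (prefixes p) ⟩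
    sum (map (λ a → length (map (encode p a) (suffixes p))) (prefixes p))
      ≡⟨ sum-constant (prefixes p) (λ a → length-map (encode p a) (suffixes p)) ⟩
    length (prefixes p) * length (suffixes p)
      ≡⟨ cong₂ _*_ (length-words forward (prefixLength p) p) (length-words backward (suffixLength p) (i ∸ p)) ⟩
    binomialTerm D m i p
      ∎
    where
    open ≡-Reasoning
    sum-constant : ∀ {k} {f : List Ori → ℕ} as → (∀ a → f a ≡ k) → sum (map f as) ≡ length as * k
    sum-constant []       _     = refl
    sum-constant (a ∷ as) f≡k = cong₂ _+_ (f≡k a) (sum-constant as f≡k)

  length-enumeration : length enumeration ≡ formula (suc m) i
  length-enumeration = begin
    length enumeration                   ≡⟨ length-concatMap candidates (upTo (suc i)) ⟩
    sum (map (λ p → length (candidates p)) (upTo (suc i)))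
                                         ≡⟨ sum-map-applyUpTo (suc i) _ (λ p → p) ⟩
    Σ< (suc i) (λ p → length (candidates p))
                                         ≡⟨ Σ<-cong (suc i) (λ p _ → length-candidates p) ⟩
    shiftedSum D m i                     ≡⟨ shiftedSum-shift i D (m ∸ (2 * i + D)) m m≡ ⟩
    shiftedSum 0 m i                     ≡⟨ Σ<-cong (suc i) (λ j _ → theorem-term j) ⟨
    Σ< (suc i) (λ j → ((2 * j) C j) * ((m ∸ 2 * j) C (i ∸ j)))
                                         ≡⟨ sum-map-applyUpTo (suc i) _ (λ j → j) ⟨
    formula (suc m) i                    ∎
    where
    open ≡-Reasoning
    2i+D≤m : 2 * i + D ℕ.≤ m
    2i+D≤m = 2i+offset≤m m h σ i m≡σ+2h i≤h
    m≡ : m ≡ 2 * i + (D + (m ∸ (2 * i + D)))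
    m≡ = trans (sym (ℕ.m+[n∸m]≡n 2i+D≤m)) (ℕ.+-assoc (2 * i) D _)
    theorem-term : ∀ j → ((2 * j) C j) * ((m ∸ 2 * j) C (i ∸ j)) ≡ binomialTerm 0 m i j
    theorem-term j rewrite ℕ.+-identityʳ (2 * j) =
      sym (cong₂ _*_ (choose≡C (2 * j) j) (choose≡C (m ∸ 2 * j) (i ∸ j)))

  prefix-isWord : ∀ p {a} → a ∈ prefixes p → IsWord forward (prefixLength p) p a
  prefix-isWord p {a} = Equivalence.to (∈-words⇔ forward (prefixLength p) p a)

  suffix-isWord : ∀ p {b} → b ∈ suffixes p → IsWord backward (suffixLength p) (i ∸ p) b
  suffix-isWord p {b} = Equivalence.to (∈-words⇔ backward (suffixLength p) (i ∸ p) b)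

  prefixLength-injective : ∀ {p p′} → p ℕ.≤ i → p′ ℕ.≤ i →
    vertex {m} (prefixLength p) ≡ vertex (prefixLength p′) → p ≡ p′
  prefixLength-injective {p} {p′} p≤i p′≤i eq = ℕ.*-cancelˡ-≡ p p′ 2 (ℕ.+-cancelʳ-≡ D (2 * p) (2 * p′)
    (trans (sym (toℕ-vertex _ (s≤s (prefixLength≤m p≤i))))
           (trans (cong toℕ eq) (toℕ-vertex _ (s≤s (prefixLength≤m p′≤i))))))

  encode-injective : ∀ {p a a′ b b′} → p ℕ.≤ i → a ∈ prefixes p → a′ ∈ prefixes p →
    b ∈ suffixes p → b′ ∈ suffixes p → encode p a b ≡ encode p a′ b′ → a ≡ a′ × b ≡ b′
  encode-injective {p} {a} {a′} {b} {b′} p≤i a∈ a′∈ b∈ b′∈ eq =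
    ++-∷-cancel a a′ _ _ b b′ (trans a≡ (sym a′≡))
      (fromWord-injective _ _ (length-word a b a≡ b≡) (length-word a′ b′ a′≡ b′≡) (cong proj₁ eq))
    where
    a≡ : length a ≡ prefixLength p
    a≡ = proj₁ (prefix-isWord p a∈)
    a′≡ : length a′ ≡ prefixLength p
    a′≡ = proj₁ (prefix-isWord p a′∈)
    b≡ : length b ≡ suffixLength p
    b≡ = proj₁ (suffix-isWord p b∈)
    b′≡ : length b′ ≡ suffixLength p
    b′≡ = proj₁ (suffix-isWord p b′∈)
    length-word : ∀ a b → length a ≡ prefixLength p → length b ≡ suffixLength p →
      length (a ++ middleLetter σ ∷ b) ≡ suc m
    length-word a b a≡ b≡ = trans (length-++ a) (word-length a b p≤i a≡ b≡)

  record Preimage (y : Pair) : Set where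
    constructor preimage
    field
      p     : ℕ
      a b   : List Ori
      p≤i   : p ℕ.≤ i
      a∈    : a ∈ prefixes p
      b∈    : b ∈ suffixes p
      y≡    : y ≡ encode p a b

  ∈-candidates⁻ : ∀ p {y} → y ∈ candidates p →
    Σ (List Ori) λ a → Σ (List Ori) λ b → a ∈ prefixes p × b ∈ suffixes p × y ≡ encode p a b
  ∈-candidates⁻ p y∈ with ∈-concatMap⁻′ _ (prefixes p) y∈
  ... | a , a∈ , y∈′ with ∈-map⁻ (encode p a) y∈′
  ... | b , b∈ , y≡ = a , b , a∈ , b∈ , y≡

  ∈-enumeration⁻ : ∀ {y} → y ∈ enumeration → Preimage y
  ∈-enumeration⁻ y∈ with ∈-concatMap⁻′ candidates (upTo (suc i)) y∈
  ... | p , p∈ , y∈′ with ∈-candidates⁻ p y∈′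
  ... | a , b , a∈ , b∈ , y≡ = preimage p a b (ℕ.≤-pred (∈-upTo⁻ p∈)) a∈ b∈ y≡

  ∈-enumeration⁺ : ∀ {y} → Preimage y → y ∈ enumeration
  ∈-enumeration⁺ (preimage p a b p≤i a∈ b∈ refl) =
    ∈-concatMap⁺′ candidates (∈-upTo⁺ (s≤s p≤i)) (∈-concatMap⁺′ _ a∈ (∈-map⁺ (encode p a) b∈))

  candidates-unique : ∀ {p} → p ℕ.≤ i → Unique (candidates p)
  candidates-unique {p} p≤i = concatMap-unique _ (prefixes p) (words-unique forward (prefixLength p) p)
    suffixes-unique prefix-determined
    where
    suffixes-unique : ∀ a → a ∈ prefixes p → Unique (map (encode p a) (suffixes p))
    suffixes-unique a a∈ = map-unique (encode p a) (suffixes p) (words-unique backward (suffixLength p) (i ∸ p))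
      λ b b′ b∈ b′∈ eq → proj₂ (encode-injective p≤i a∈ a∈ b∈ b′∈ eq)
    prefix-determined : ∀ a a′ y → a ∈ prefixes p → a′ ∈ prefixes p →
      y ∈ map (encode p a) (suffixes p) → y ∈ map (encode p a′) (suffixes p) → a ≡ a′
    prefix-determined a a′ y a∈ a′∈ y∈ y∈′ with ∈-map⁻ (encode p a) y∈ | ∈-map⁻ (encode p a′) y∈′
    ... | b , b∈ , y≡ | b′ , b′∈ , y≡′ =
      proj₁ (encode-injective p≤i a∈ a′∈ b∈ b′∈ (trans (sym y≡) y≡′))

  candidates-disjoint : ∀ {p p′ y} → p ℕ.≤ i → p′ ℕ.≤ i →
    y ∈ candidates p → y ∈ candidates p′ → p ≡ p′
  candidates-disjoint {p} {p′} p≤i p′≤i y∈ y∈′ with ∈-candidates⁻ p y∈ | ∈-candidates⁻ p′ y∈′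
  ... | _ , _ , _ , _ , y≡ | _ , _ , _ , _ , y≡′ =
    prefixLength-injective p≤i p′≤i (allBut-injective _ _ (cong proj₂ (trans (sym y≡) y≡′)))

  enumeration-unique : Unique enumeration
  enumeration-unique = concatMap-unique candidates (upTo (suc i)) (upTo⁺ (suc i))
    (λ p p∈ → candidates-unique (below p∈)) (λ p p′ y p∈ p′∈ → candidates-disjoint (below p∈) (below p′∈))
    where
    below : ∀ {p} → p ∈ upTo (suc i) → p ℕ.≤ i
    below p∈ = ℕ.≤-pred (∈-upTo⁻ p∈)

  preimage⇒characterised : ∀ {y} → Preimage y → Characterised i y
  preimage⇒characterised (preimage p a b p≤i a∈ b∈ refl) with prefix-isWord p a∈ | suffix-isWord p b∈
  ... | a≡ , all-a , #fwd-a | b≡ , all-b , #bwd-b = vertex (prefixLength p) , refl ,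
    subst (λ k → Conditions i (fromWord w) (vertex k)) a≡
      (Equivalence.from (conditions⇔wordConditions a s b (word-length a b p≤i a≡ b≡) i)
        (all-a , all-b , middleLetter≢bwd σ , balanced , towards))
    where
    s = middleLetter σ
    w = a ++ s ∷ b
    balanced : tally #fwd w ≡ tally #bwd w
    balanced = begin
      tally #fwd w
        ≡⟨ tally-++ #fwd a s b ⟩
      tally #fwd a + (#fwd s + tally #fwd b)
        ≡⟨ cong₂ (λ u v → u + (v + tally #fwd b)) #fwd-a (#fwd-middleLetter σ σ≤1) ⟩
      p + (σ + tally #fwd b)
        ≡⟨ shape⇒balanced m h σ i p (tally #bwd a) (tally #fwd b) (length b) m≡σ+2h i≤h p≤i a-split b-split b≡ ⟩
      tally #bwd a + (0 + (i ∸ p))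
        ≡⟨ cong₂ (λ u v → tally #bwd a + (u + v)) (#bwd-middleLetter σ) #bwd-b ⟨
      tally #bwd a + (#bwd s + tally #bwd b)
        ≡⟨ tally-++ #bwd a s b ⟨
      tally #bwd w
        ∎
      where
      open ≡-Reasoning
      a-split : p + tally #bwd a ≡ prefixLength p
      a-split = trans (cong (_+ tally #bwd a) (sym #fwd-a)) (trans (tally-#fwd+#bwd a all-a) a≡)
      b-split : tally #fwd b + (i ∸ p) ≡ length b
      b-split = trans (cong (tally #fwd b +_) (sym #bwd-b)) (tally-#fwd+#bwd b all-b)
    towards : tally #fwd a + tally #bwd b ≡ i
    towards = trans (cong₂ _+_ #fwd-a #bwd-b) (ℕ.m+[n∸m]≡n p≤i)

  -- Split the word of G at the non-tree edge; the arithmetic of the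
  -- balance condition then pins down p, the lengths and the middle letter.
  characterised⇒preimage : ∀ {G T} → Characterised i (G , T) → Preimage (G , T)
  characterised⇒preimage {G} {T} (x , T≡ , conditions) with toWord-split G x
  ... | a , b , a≡x , len , G≡ with Equivalence.to (conditions⇔wordConditions a (lookup G x) b len i)
                                    (subst₂ (Conditions i) G≡ x≡ conditions)
    where
    x≡ : x ≡ vertex (length a)
    x≡ = trans (sym (vertex-toℕ x)) (cong vertex (sym a≡x))
  ... | all-a , all-b , not-bwd , balanced , towards = preimage p a b p≤i a∈ b∈ GT≡
    where
    s = lookup G x
    p = tally #fwd a
    Q = tally #bwd b
    balanced′ : p + (#fwd s + tally #fwd b) ≡ tally #bwd a + (0 + Q)
    balanced′ = trans (sym (tally-++ #fwd a s b)) (trans balanced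
      (trans (tally-++ #bwd a s b) (cong (λ v → tally #bwd a + (v + Q)) (#bwd-≢bwd not-bwd))))
    shape : #fwd s ≡ σ × length a ≡ prefixLength p
    shape = balanced⇒shape m h σ i (length a) (length b) p Q (tally #bwd a) (tally #fwd b) (#fwd s)
      m≡σ+2h σ≤1 (#fwd≤1 s) i≤h (tally-#fwd+#bwd a all-a) (tally-#fwd+#bwd b all-b) len towards balanced′
    a≡ : length a ≡ prefixLength p
    a≡ = proj₂ shape
    p≤i : p ℕ.≤ i
    p≤i = subst (p ℕ.≤_) towards (ℕ.m≤m+n p Q)
    b≡ : length b ≡ suffixLength p
    b≡ = trans (sym (ℕ.m+n∸m≡n (length a) (length b)))
      (cong₂ _∸_ (ℕ.suc-injective (trans (sym (ℕ.+-suc (length a) (length b))) len)) a≡)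
    a∈ : a ∈ prefixes p
    a∈ = Equivalence.from (∈-words⇔ forward (prefixLength p) p a) (a≡ , all-a , refl)
    b∈ : b ∈ suffixes p
    b∈ = Equivalence.from (∈-words⇔ backward (suffixLength p) (i ∸ p) b)
      (b≡ , all-b , trans (sym (ℕ.m+n∸m≡n p Q)) (cong (_∸ p) towards))
    GT≡ : (G , T) ≡ encode p a b
    GT≡ = cong₂ _,_ (trans G≡ (cong (λ z → fromWord (a ++ z ∷ b)) (middleLetter-unique σ not-bwd (proj₁ shape))))
      (trans T≡ (cong allBut (trans (trans (sym (vertex-toℕ x)) (cong vertex (sym a≡x))) (cong vertex a≡))))

  ∈-enumeration⇔counted : ∀ y → y ∈ enumeration ⇔ Counted (suc m) i y
  ∈-enumeration⇔counted (G , T) = mk⇔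
    (λ y∈ → characterised⇒counted i G T (preimage⇒characterised (∈-enumeration⁻ y∈)))
    (λ counted → ∈-enumeration⁺ (characterised⇒preimage (counted⇒characterised 1≤m i G T counted)))

  counted-hasCard : HasCard (Counted (suc m) i) (formula (suc m) i)
  counted-hasCard = enumeration , enumeration-unique , ∈-enumeration⇔counted , length-enumeration

lemma6p3 : (n : ℕ) → 3 ≤ n → (i : ℕ) → i ≤ (n ∸ 1) / 2 →
    HasCard (Counted n i) (formula n i)
lemma6p3 (suc m) (s≤s 2≤m) i i≤h = Enumeration.counted-hasCard m i (≤-trans (s≤s z≤n) 2≤m) i≤h
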